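{- Let $c\ge 1$ be an integer and let $G^+(2,c)$ be the graph on $2c+1$ vertices described in the context, with vertices ordered $v_1,\dots,v_{2c+1}$ as described there. Then the Laplacian spectrum of $G^+(2,c)$ is $$\{2c+1,\,2c,\,\ldots,\,c+2,\,c,\,c-1,\,\ldots,\,1,\,0\},$$ i.e. every integer from $0$ to $2c+1$ except $c+1$, each with multiplicity one. Moreover, writing vectors in $\mathbb{R}^{2c+1}$ with respect to the ordering $v_1,\dots,v_{2c+1}$ and using $a^k$ for $k$ consecutive entries equal to $a$, the following vectors $\mathbf{x}^{(0)},\dots,\mathbf{x}^{(2c)}$ are eigenvectors of the Laplacian matrix: \begin{itemize} \item for $r=0,\ldots,c-1$: $\mathbf{x}^{(r)}=(0^r,\,-2(c-r),\,1^{2(c-r)},\,0^r)$, with eigenvalue $2c+1-r$; \item $\mathbf{x}^{(c)}=(0^c,\,-1,\,1,\,0^{c-1})$, with eigenvalue $c$; \item for $r=c+1,\ldots,2c-1$: $\mathbf{x}^{(r)}=(0^{2c-r},\,(-1)^{2(r-c)+1},\,2(r-c)+1,\,0^{2c-r-1})$, with eigenvalue $2c-r$; \item $\mathbf{x}^{(2c)}=(1^{2c+1})$, with eigenvalue $0$. \end{itemize}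
   Context: For integers $d,c\ge1$, the graph $G(d,c)$ has as vertices the combinations with repetition of $c$ elements from $\{1,\dots,d\}$, written as nondecreasing sequences $x=x_1x_2\ldots x_c$; two distinct vertices $x,y$ are adjacent iff $|x_i-y_i|\in\{0,1\}$ for every $i=1,\dots,c$. The graph $G^+(d,c)$ is obtained from $G(d,c)$ by adding $c$ new vertices $w_1,\dots,w_c$ and joining each $w_i$ to every vertex of $G(d,c)$ whose label contains at least $i$ entries equal to $1$ (there are no edges among the $w_i$). For $d=2$, $G(2,c)$ has the $c+1$ vertices $u_k=1^{c+1-k}2^{k-1}$ ($k$ ones followed by twos, $k=1,\dots,c+1$), i.e. $u_k$ consists of $c+1-k$ ones followed by $k-1$ twos, and these form a complete graph $K_{c+1}$. The vertex ordering used is $v_k=u_k$ for $k=1,\dots,c+1$ (so $v_1=11\ldots1$ and $v_{c+1}=22\ldots2$) and $v_{c+1+i}=w_i$ for $i=1,\dots,c$. Equivalently, the edges of $G^+(2,c)$ are exactly the pairs $\{v_h,v_j\}$ with $1\le h\le c$ and $h+1\le j\le 2c+2-h$. The Laplacian matrix is $L=D-A$, where $A$ is the adjacency matrix and $D$ the diagonal matrix of vertex degrees; the Laplacian spectrum is the multiset of eigenvalues of $L$. -}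

module Defs where

open import Data.Bool using (Bool; true; false; if_then_else_; _∧_; not)
open import Data.Nat as ℕ using (ℕ; zero; suc; _∸_; _≡ᵇ_; _<ᵇ_; _≤ᵇ_)
open import Data.Integer as ℤ using (ℤ; +_; -_; _-_)
open import Data.Fin using (Fin; toℕ; punchIn)
import Data.Fin as F
open import Data.List using (List; []; _∷_; replicate; _++_; length; filter; zipWith; upTo; map; foldr)
open import Data.Bool.ListAction using (and)
open import Data.Product using (Σ; _×_; _,_)
open import Relation.Nullary using (¬_)
open import Relation.Binary.PropositionalEquality using (_≡_)

Matrix : ℕ → Set
Matrix n = Fin n → Fin n → ℤ

Vector : ℕ → Set
Vector n = Fin n → ℤ

∑ : ∀ {n} → (Fin n → ℤ) → ℤ
∑ {zero}  f = + 0
∑ {suc n} f = f F.zero ℤ.+ ∑ (λ i → f (F.suc i))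

sgn : ℕ → ℤ
sgn zero = + 1
sgn (suc k) = - sgn k

det : ∀ {n} → Matrix n → ℤ
det {zero}  M = + 1
det {suc n} M = ∑ (λ j → sgn (toℕ j) ℤ.* M F.zero j ℤ.* det (λ a b → M (F.suc a) (punchIn j b)))

charPoly : ∀ {n} → Matrix n → ℤ → ℤ
charPoly {n} M t = det (λ i j → (if toℕ i ≡ᵇ toℕ j then t else + 0) - M i j)

degree : ∀ {n} → (Fin n → Fin n → Bool) → Fin n → ℤ
degree adj i = ∑ (λ j → if adj i j then + 1 else + 0)

laplacian : ∀ {n} → (Fin n → Fin n → Bool) → Matrix n
laplacian adj i j =
  (if toℕ i ≡ᵇ toℕ j then degree adj i else + 0) - (if adj i j then + 1 else + 0)

_·_ : ∀ {n} → Matrix n → Vector n → Vector n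
(M · x) i = ∑ (λ j → M i j ℤ.* x j)

IsEigenvector : ∀ {n} → Matrix n → ℤ → Vector n → Set
IsEigenvector M λ' x = (¬ (∀ i → x i ≡ + 0)) × (∀ i → (M · x) i ≡ λ' ℤ.* x i)

-- The graph G⁺(2,c), vertices indexed 0..2c by Fin (2c+1):
--   index a ≤ c     : v_{a+1} = u_{a+1} = 1^{c-a} 2^{a}
--   index c + i     : v_{c+1+i} = w_i   (i = 1..c)

label : ℕ → ℕ → List ℕ
label c a = replicate (c ∸ a) 1 ++ replicate a 2

numOnes : List ℕ → ℕ
numOnes xs = length (filter (λ x → x ℕ.≟ 1) xs)

close : ℕ → ℕ → Bool
close x y = ((x ∸ y) ≤ᵇ 1) ∧ ((y ∸ x) ≤ᵇ 1)

adjG : List ℕ → List ℕ → Bool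
adjG x y = not (x ≡ᴸ y) ∧ and (zipWith close x y)
  where
  _≡ᴸ_ : List ℕ → List ℕ → Bool
  [] ≡ᴸ [] = true
  (a ∷ as) ≡ᴸ (b ∷ bs) = (a ≡ᵇ b) ∧ (as ≡ᴸ bs)
  _ ≡ᴸ _ = false

adjPlusℕ : ℕ → ℕ → ℕ → Bool
adjPlusℕ c a b with a ≤ᵇ c | b ≤ᵇ c
... | true  | true  = adjG (label c a) (label c b)
... | true  | false = (b ∸ c) ≤ᵇ numOnes (label c a)
... | false | true  = (a ∸ c) ≤ᵇ numOnes (label c b)
... | false | false = false

adjPlus : (c : ℕ) → Fin (2 ℕ.* c ℕ.+ 1) → Fin (2 ℕ.* c ℕ.+ 1) → Bool
adjPlus c i j = adjPlusℕ c (toℕ i) (toℕ j)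

L⁺ : (c : ℕ) → Matrix (2 ℕ.* c ℕ.+ 1)
L⁺ c = laplacian (adjPlus c)

spectrum : ℕ → List ℕ
spectrum c = upTo (suc c) ++ map (λ j → c ℕ.+ 2 ℕ.+ j) (upTo c)

prodℤ : List ℤ → ℤ
prodℤ = foldr ℤ._*_ (+ 1)

-- Eigenvectors, on 0-based position i

xLow : ℕ → ℕ → ℕ → ℤ
xLow c r i =
  if i <ᵇ r then + 0
  else if i ≡ᵇ r then - (+ (2 ℕ.* (c ∸ r)))
  else if i ≤ᵇ r ℕ.+ 2 ℕ.* (c ∸ r) then + 1
  else + 0

xMid : ℕ → ℕ → ℤ
xMid c i =
  if i ≡ᵇ c then - (+ 1)
  else if i ≡ᵇ suc c then + 1
  else + 0

xHigh : ℕ → ℕ → ℕ → ℤ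
xHigh c r i =
  if i <ᵇ 2 ℕ.* c ∸ r then + 0
  else if i <ᵇ (2 ℕ.* c ∸ r) ℕ.+ (2 ℕ.* (r ∸ c) ℕ.+ 1) then - (+ 1)
  else if i ≡ᵇ (2 ℕ.* c ∸ r) ℕ.+ (2 ℕ.* (r ∸ c) ℕ.+ 1) then + (2 ℕ.* (r ∸ c) ℕ.+ 1)
  else + 0

xTop : ℕ → ℤ
xTop i = + 1

{-# OPTIONS --safe #-}
module Submission where

-- Numbered 0,…,2c in the given order, the vertices of G⁺(2,c) form a threshold
-- graph: a ~ b iff a ≠ b and a + b ≤ 2c. Vertex 0 is adjacent to all others,
-- vertex 2c only to 0, and the vertices in between induce the graph for c − 1
-- with every degree raised by one. Hence an eigenvector of the smaller Laplacian
-- with zero sum, padded by a zero at each end, is an eigenvector of the larger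
-- one for the eigenvalue raised by one, and the listed eigenvectors all arise in
-- this way from (−L, 1, …, 1) with eigenvalue L + 1 and (0, −1, …, −1, L) with
-- eigenvalue 1.
--
-- The rows of t I − L sum to t, so adding all columns to column 0 gives
-- det (t I − L) = t Q, where Q is det (t I − L) with column 0 replaced by ones.
-- Pivoting on vertex 0, using constant row sums once more and expanding along
-- the column of the pendant vertex gives Q_c(t) = (t − 2c − 1)(t − 1) Q_{c−1}(t − 1).
-- As det is Laplace expansion along the first row, these column operations rest
-- on multilinearity and alternation in the columns. Alternation holds for
-- adjacent columns because the two terms of the expansion that do not vanish
-- cancel, and it extends to arbitrary columns by swapping neighbours.

open import Defs

module ThresholdGraph where
  open import Data.Bool using (Bool; true; false; if_then_else_; not; _∧_)
  open import Data.Bool.ListAction using (and)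
  open import Data.Bool.Properties using (∧-identityʳ; ∧-zeroʳ)
  open import Data.Fin using (Fin; toℕ; punchIn)
  import Data.Fin as F
  import Data.Fin.Properties as FP
  open import Data.Integer using (ℤ; +_; -_; _-_; _+_; _*_)
  import Data.Integer.Properties as ℤP
  open import Data.Integer.Tactic.RingSolver using (solve-∀)
  open import Data.List using (List; []; _∷_; [_]; replicate; _++_; zipWith; map; applyUpTo; upTo)
  import Data.List.Properties as LP
  open import Data.Nat as ℕ using (ℕ; zero; suc; _≤_; _<_; _∸_; _≡ᵇ_; _≤ᵇ_; z≤n; s≤s)
  import Data.Nat.Properties as ℕP
  import Data.Nat.Tactic.RingSolver as NS
  open import Data.Product using (Σ; _×_; _,_)
  open import Function using (_∘_; _⇔_; mk⇔; Equivalence)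
  open import Relation.Binary.Definitions using (tri<; tri≈; tri>)
  open import Relation.Binary.PropositionalEquality
    using (_≡_; _≢_; refl; sym; trans; cong; cong₂; subst; subst₂; module ≡-Reasoning)
  open import Relation.Nullary using (¬_; contradiction; yes; no)
  open import Relation.Nullary.Reflects using (Reflects; ofʸ; ofⁿ; fromEquivalence)
  import Relation.Nullary.Reflects as Reflects
  open import Algebra.Properties.Semiring.Sum ℤP.+-*-semiring
    using (sum; sum-cong-≗; sum-replicate-zero; ∑-distrib-+; *-distribˡ-sum; *-distribʳ-sum)

  open ≡-Reasoning

  reflects-≡ : ∀ {P Q : Set} {x y : Bool} → Reflects P x → Reflects Q y → (P → Q) → (Q → P) → x ≡ y
  reflects-≡ (ofʸ _)  (ofʸ _)  _   _   = refl
  reflects-≡ (ofʸ p)  (ofⁿ ¬q) p→q _   = contradiction (p→q p) ¬q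
  reflects-≡ (ofⁿ ¬p) (ofʸ q)  _   q→p = contradiction (q→p q) ¬p
  reflects-≡ (ofⁿ _)  (ofⁿ _)  _   _   = refl

  ≡ᵇ-reflects : ∀ m n → Reflects (m ≡ n) (m ≡ᵇ n)
  ≡ᵇ-reflects m n = fromEquivalence (ℕP.≡ᵇ⇒≡ m n) (ℕP.≡⇒≡ᵇ m n)

  ≡ᵇ-refl : ∀ n → (n ≡ᵇ n) ≡ true
  ≡ᵇ-refl n = Reflects.det (≡ᵇ-reflects n n) (ofʸ refl)

  ≢⇒≡ᵇ-false : ∀ {m n} → m ≢ n → (m ≡ᵇ n) ≡ false
  ≢⇒≡ᵇ-false m≢n = Reflects.det (≡ᵇ-reflects _ _) (ofⁿ m≢n)

  <⇒<ᵇ-true : ∀ {m n} → m < n → (m ℕ.<ᵇ n) ≡ true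
  <⇒<ᵇ-true m<n = Reflects.det (ℕP.<ᵇ-reflects-< _ _) (ofʸ m<n)

  ≮⇒<ᵇ-false : ∀ {m n} → ¬ m < n → (m ℕ.<ᵇ n) ≡ false
  ≮⇒<ᵇ-false m≮n = Reflects.det (ℕP.<ᵇ-reflects-< _ _) (ofⁿ m≮n)

  ≤⇒≤ᵇ-true : ∀ {m n} → m ≤ n → (m ≤ᵇ n) ≡ true
  ≤⇒≤ᵇ-true m≤n = Reflects.det (ℕP.≤ᵇ-reflects-≤ _ _) (ofʸ m≤n)

  ≰⇒≤ᵇ-false : ∀ {m n} → ¬ m ≤ n → (m ≤ᵇ n) ≡ false
  ≰⇒≤ᵇ-false m≰n = Reflects.det (ℕP.≤ᵇ-reflects-≤ _ _) (ofⁿ m≰n)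

  <ᵇ-suc : ∀ {b k} → b ≢ k → (b ℕ.<ᵇ suc k) ≡ (b ℕ.<ᵇ k)
  <ᵇ-suc b≢k = reflects-≡ (ℕP.<ᵇ-reflects-< _ _) (ℕP.<ᵇ-reflects-< _ _)
    (λ b<sk → ℕP.≤∧≢⇒< (ℕP.≤-pred b<sk) b≢k) (λ b<k → ℕP.<-trans b<k (ℕP.n<1+n _))

  ≤ᵇ-suc : ∀ m n → (suc m ≤ᵇ suc n) ≡ (m ≤ᵇ n)
  ≤ᵇ-suc zero    n = refl
  ≤ᵇ-suc (suc m) n = refl

  x+y≡z⇒y≡z-x : ∀ x y z → x + y ≡ z → y ≡ z - x
  x+y≡z⇒y≡z-x x y _ refl = lemma x y
    where
    lemma : ∀ x y → y ≡ (x + y) - x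
    lemma = solve-∀

  -[+n]≢0 : ∀ {n} → 0 < n → - (+ n) ≢ + 0
  -[+n]≢0 {suc n} _ ()

  sumℕ : ℕ → (ℕ → ℤ) → ℤ
  sumℕ n f = sum {n} (λ i → f (toℕ i))

  ∑≡sumℕ : ∀ {n} (f : Fin n → ℤ) (g : ℕ → ℤ) → (∀ i → f i ≡ g (toℕ i)) → ∑ f ≡ sumℕ n g
  ∑≡sumℕ {zero}  f g f≗g = refl
  ∑≡sumℕ {suc n} f g f≗g =
    cong₂ _+_ (f≗g F.zero) (∑≡sumℕ (λ i → f (F.suc i)) (λ i → g (suc i)) (λ i → f≗g (F.suc i)))

  sumℕ-cong : ∀ n {f g : ℕ → ℤ} → (∀ i → i < n → f i ≡ g i) → sumℕ n f ≡ sumℕ n g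
  sumℕ-cong n f≗g = sum-cong-≗ (λ i → f≗g (toℕ i) (FP.toℕ<n i))

  sumℕ-zero : ∀ n {f : ℕ → ℤ} → (∀ i → i < n → f i ≡ + 0) → sumℕ n f ≡ + 0
  sumℕ-zero n f≗0 = trans (sumℕ-cong n f≗0) (sum-replicate-zero n)

  sumℕ-+ : ∀ n (f g : ℕ → ℤ) → sumℕ n (λ i → f i + g i) ≡ sumℕ n f + sumℕ n g
  sumℕ-+ n f g = ∑-distrib-+ {n} (λ i → f (toℕ i)) (λ i → g (toℕ i))

  sumℕ-*ˡ : ∀ n x (f : ℕ → ℤ) → sumℕ n (λ i → x * f i) ≡ x * sumℕ n f
  sumℕ-*ˡ n x f = sym (*-distribˡ-sum {n} x (λ i → f (toℕ i)))

  sumℕ-*ʳ : ∀ n (f : ℕ → ℤ) x → sumℕ n (λ i → f i * x) ≡ sumℕ n f * x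
  sumℕ-*ʳ n f x = sym (*-distribʳ-sum {n} x (λ i → f (toℕ i)))

  sumℕ-neg : ∀ n (f : ℕ → ℤ) → sumℕ n (λ i → - f i) ≡ - sumℕ n f
  sumℕ-neg n f = begin
    sumℕ n (λ i → - f i)          ≡⟨ sumℕ-cong n (λ i _ → sym (ℤP.-1*i≡-i (f i))) ⟩
    sumℕ n (λ i → - + 1 * f i)    ≡⟨ sumℕ-*ˡ n (- + 1) f ⟩
    - + 1 * sumℕ n f              ≡⟨ ℤP.-1*i≡-i (sumℕ n f) ⟩
    - sumℕ n f                    ∎

  sumℕ-sub : ∀ n (f g : ℕ → ℤ) → sumℕ n (λ i → f i - g i) ≡ sumℕ n f - sumℕ n g
  sumℕ-sub n f g = trans (sumℕ-+ n f (λ i → - g i)) (cong (λ x → sumℕ n f + x) (sumℕ-neg n g))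

  sumℕ-snoc : ∀ n (f : ℕ → ℤ) → sumℕ (suc n) f ≡ sumℕ n f + f n
  sumℕ-snoc zero    f = ℤP.+-comm (f 0) (+ 0)
  sumℕ-snoc (suc n) f = trans (cong (λ s → f 0 + s) (sumℕ-snoc n (λ i → f (suc i)))) (sym (ℤP.+-assoc (f 0) _ _))

  sumℕ-const : ∀ n x → sumℕ n (λ _ → x) ≡ + n * x
  sumℕ-const zero    x = sym (ℤP.*-zeroˡ x)
  sumℕ-const (suc n) x = trans (cong (λ s → x + s) (sumℕ-const n x)) (sym (ℤP.suc-* (+ n) x))

  δ-* : ∀ a b d (y : ℕ → ℤ) → (if a ≡ᵇ b then d else + 0) * y b ≡ (if a ≡ᵇ b then d * y a else + 0)
  δ-* a b d y with a ≡ᵇ b | ≡ᵇ-reflects a b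
  ... | true  | ofʸ refl = refl
  ... | false | _        = ℤP.*-zeroˡ (y b)

  sumℕ-δ : ∀ n a v → a < n → sumℕ n (λ b → if a ≡ᵇ b then v else + 0) ≡ v
  sumℕ-δ (suc n) zero    v _         = trans (cong (λ s → v + s) (sumℕ-zero n (λ _ _ → refl))) (ℤP.+-identityʳ v)
  sumℕ-δ (suc n) (suc a) v (s≤s a<n) = trans (ℤP.+-identityˡ _) (sumℕ-δ n a v a<n)

  sumℕ-pair : ∀ n j (f : ℕ → ℤ) → suc j < n → f j + f (suc j) ≡ + 0 →
    (∀ k → k < n → k ≢ j → k ≢ suc j → f k ≡ + 0) → sumℕ n f ≡ + 0
  sumℕ-pair (suc (suc n)) zero f _ pair rest = begin
    f 0 + (f 1 + sumℕ n (λ k → f (suc (suc k))))  ≡⟨ sym (ℤP.+-assoc (f 0) (f 1) _) ⟩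
    (f 0 + f 1) + sumℕ n (λ k → f (suc (suc k)))  ≡⟨ cong₂ _+_ pair (sumℕ-zero n λ k k<n →
                                                       rest (suc (suc k)) (s≤s (s≤s k<n)) (λ ()) (λ ())) ⟩
    + 0                                           ∎
  sumℕ-pair (suc n) (suc j) f (s≤s j<n) pair rest =
    cong₂ _+_ (rest 0 (s≤s z≤n) (λ ()) (λ ())) (sumℕ-pair n j (λ k → f (suc k)) j<n pair
      (λ k k<n k≢j k≢sj → rest (suc k) (s≤s k<n) (k≢j ∘ ℕP.suc-injective) (k≢sj ∘ ℕP.suc-injective)))

  sumℕ-truncate : ∀ m n (f : ℕ → ℤ) → m ≤ n → (∀ i → m ≤ i → i < n → f i ≡ + 0) →
    sumℕ n f ≡ sumℕ m f
  sumℕ-truncate zero    n       f _         f≗0 = sumℕ-zero n (λ i → f≗0 i z≤n)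
  sumℕ-truncate (suc m) (suc n) f (s≤s m≤n) f≗0 =
    cong (λ s → f 0 + s) (sumℕ-truncate m n (λ i → f (suc i)) m≤n
                            (λ i m≤i i<n → f≗0 (suc i) (s≤s m≤i) (s≤s i<n)))

  -- Determinants by expansion along the first row

  punchInℕ : ℕ → ℕ → ℕ
  punchInℕ zero    b       = suc b
  punchInℕ (suc j) zero    = zero
  punchInℕ (suc j) (suc b) = suc (punchInℕ j b)

  toℕ-punchIn : ∀ {n} (j : Fin (suc n)) (b : Fin n) → toℕ (punchIn j b) ≡ punchInℕ (toℕ j) (toℕ b)
  toℕ-punchIn F.zero    b         = refl
  toℕ-punchIn (F.suc j) F.zero    = refl
  toℕ-punchIn (F.suc j) (F.suc b) = cong suc (toℕ-punchIn j b)

  punchInℕ-≥ : ∀ {j b} → j ≤ b → punchInℕ j b ≡ suc b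
  punchInℕ-≥ {zero}          _         = refl
  punchInℕ-≥ {suc j} {suc b} (s≤s j≤b) = cong suc (punchInℕ-≥ j≤b)

  punchInℕ-≢ : ∀ j b → punchInℕ j b ≢ j
  punchInℕ-≢ (suc j) (suc b) eq = punchInℕ-≢ j b (ℕP.suc-injective eq)

  punchInℕ-injective : ∀ j {b c} → punchInℕ j b ≡ punchInℕ j c → b ≡ c
  punchInℕ-injective zero    eq = ℕP.suc-injective eq
  punchInℕ-injective (suc j) {zero}  {zero}  _  = refl
  punchInℕ-injective (suc j) {suc b} {suc c} eq = cong suc (punchInℕ-injective j (ℕP.suc-injective eq))

  punchInℕ-< : ∀ {n} j b → j < suc n → b < n → punchInℕ j b < suc n
  punchInℕ-< zero    b       _         b<n       = s≤s b<n
  punchInℕ-< (suc j) zero    (s≤s j<n) _         = s≤s z≤n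
  punchInℕ-< (suc j) (suc b) (s≤s j<n) (s≤s b<n) = s≤s (punchInℕ-< j b j<n b<n)

  punchInℕ-preimage : ∀ {n j k} → j < suc n → k < suc n → j ≢ k →
    Σ ℕ λ k′ → k′ < n × punchInℕ j k′ ≡ k
  punchInℕ-preimage {n}     {zero}  {zero}  _         _         j≢k = contradiction refl j≢k
  punchInℕ-preimage {n}     {zero}  {suc k} _         (s≤s k<n) _   = k , k<n , refl
  punchInℕ-preimage {zero}  {suc j} {zero}  (s≤s ()) _         _
  punchInℕ-preimage {suc n} {suc j} {zero}  _         _         _   = zero , s≤s z≤n , refl
  punchInℕ-preimage {suc n} {suc j} {suc k} (s≤s j<n) (s≤s k<n) j≢k
    with k′ , k′<n , eq ← punchInℕ-preimage j<n k<n (j≢k ∘ cong suc) = suc k′ , s≤s k′<n , cong suc eq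

  punchInℕ-adjacentPreimage : ∀ {n} k j → k < suc n → suc j < suc n → k ≢ j → k ≢ suc j →
    Σ ℕ λ j′ → suc j′ < n × punchInℕ k j′ ≡ j × punchInℕ k (suc j′) ≡ suc j
  punchInℕ-adjacentPreimage zero          zero    _ _ k≢j _ = contradiction refl k≢j
  punchInℕ-adjacentPreimage zero          (suc j) _ (s≤s sj<n) _ _ = j , sj<n , refl , refl
  punchInℕ-adjacentPreimage (suc zero)    zero    _ _ _ k≢sj = contradiction refl k≢sj
  punchInℕ-adjacentPreimage (suc (suc k)) zero    (s≤s k<n) _ _ _ =
    zero , ℕP.≤-trans (s≤s (s≤s z≤n)) k<n , refl , refl
  punchInℕ-adjacentPreimage {suc n} (suc k) (suc j) (s≤s k<n) (s≤s sj<n) k≢j k≢sj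
    with j′ , sj′<n , eq₁ , eq₂ ← punchInℕ-adjacentPreimage k j k<n sj<n (k≢j ∘ cong suc) (k≢sj ∘ cong suc)
    = suc j′ , s≤s sj′<n , cong suc eq₁ , cong suc eq₂

  punchInℕ-adjacent : ∀ (v : ℕ → ℤ) j b → v j ≡ v (suc j) → v (punchInℕ j b) ≡ v (punchInℕ (suc j) b)
  punchInℕ-adjacent v zero    zero    eq = sym eq
  punchInℕ-adjacent v zero    (suc b) eq = refl
  punchInℕ-adjacent v (suc j) zero    eq = refl
  punchInℕ-adjacent v (suc j) (suc b) eq = punchInℕ-adjacent (λ c → v (suc c)) j b eq

  -- detℕ n reads only the entries below n, so a leading block of a matrix is the
  -- same function taken at a smaller size.
  Matrixℕ : Set
  Matrixℕ = ℕ → ℕ → ℤ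

  minor : Matrixℕ → ℕ → Matrixℕ
  minor M j a b = M (suc a) (punchInℕ j b)

  detℕ : ℕ → Matrixℕ → ℤ
  detℕ zero    M = + 1
  detℕ (suc n) M = sumℕ (suc n) (λ j → sgn j * M 0 j * detℕ n (minor M j))

  det≡detℕ : ∀ {n} (M : Matrix n) (N : Matrixℕ) → (∀ i j → M i j ≡ N (toℕ i) (toℕ j)) →
    det M ≡ detℕ n N
  det≡detℕ {zero}  M N M≗N = refl
  det≡detℕ {suc n} M N M≗N = ∑≡sumℕ _ (λ j → sgn j * N 0 j * detℕ n (minor N j)) λ j →
    cong₂ (λ x y → sgn (toℕ j) * x * y) (M≗N F.zero j)
      (det≡detℕ _ (minor N (toℕ j)) λ a b →
         trans (M≗N (F.suc a) (punchIn j b)) (cong (N (suc (toℕ a))) (toℕ-punchIn j b)))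

  detℕ-cong : ∀ n {M N : Matrixℕ} → (∀ a b → a < n → b < n → M a b ≡ N a b) → detℕ n M ≡ detℕ n N
  detℕ-cong zero    _   = refl
  detℕ-cong (suc n) M≗N = sumℕ-cong (suc n) λ j j<n →
    cong₂ (λ x y → sgn j * x * y) (M≗N 0 j (s≤s z≤n) j<n)
      (detℕ-cong n λ a b a<n b<n → M≗N (suc a) (punchInℕ j b) (s≤s a<n) (punchInℕ-< j b j<n b<n))

  detℕ-linear : ∀ n j (M A B : Matrixℕ) (α β : ℤ) → j < n →
    (∀ a b → b ≢ j → M a b ≡ A a b) → (∀ a b → b ≢ j → B a b ≡ A a b) →
    (∀ a → M a j ≡ α * A a j + β * B a j) →
    detℕ n M ≡ α * detℕ n A + β * detℕ n B
  detℕ-linear (suc n) j M A B α β j<n M≈A B≈A Mʲ = begin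
      sumℕ (suc n) (term M)
    ≡⟨ sumℕ-cong (suc n) term-linear ⟩
      sumℕ (suc n) (λ k → α * term A k + β * term B k)
    ≡⟨ sumℕ-+ (suc n) (λ k → α * term A k) (λ k → β * term B k) ⟩
      sumℕ (suc n) (λ k → α * term A k) + sumℕ (suc n) (λ k → β * term B k)
    ≡⟨ cong₂ _+_ (sumℕ-*ˡ (suc n) α (term A)) (sumℕ-*ˡ (suc n) β (term B)) ⟩
      α * detℕ (suc n) A + β * detℕ (suc n) B ∎
    where
    term : Matrixℕ → ℕ → ℤ
    term X k = sgn k * X 0 k * detℕ n (minor X k)
    distrib₁ : ∀ α β s x y d → s * (α * x + β * y) * d ≡ α * (s * x * d) + β * (s * y * d)
    distrib₁ = solve-∀
    distrib₂ : ∀ α β s x d e → s * x * (α * d + β * e) ≡ α * (s * x * d) + β * (s * x * e)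
    distrib₂ = solve-∀
    term-linear : ∀ k → k < suc n → term M k ≡ α * term A k + β * term B k
    term-linear k k<n with k ℕP.≟ j
    ... | yes refl = begin
        sgn k * M 0 k * detℕ n (minor M k)
      ≡⟨ cong₂ (λ x y → sgn k * x * y) (Mʲ 0) (detℕ-cong n (λ a b _ _ → M≈A (suc a) _ (punchInℕ-≢ k b))) ⟩
        sgn k * (α * A 0 k + β * B 0 k) * detℕ n (minor A k)
      ≡⟨ distrib₁ α β (sgn k) (A 0 k) (B 0 k) _ ⟩
        α * term A k + β * (sgn k * B 0 k * detℕ n (minor A k))
      ≡⟨ cong (λ d → α * term A k + β * (sgn k * B 0 k * d))
              (detℕ-cong n (λ a b _ _ → sym (B≈A (suc a) _ (punchInℕ-≢ k b)))) ⟩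
        α * term A k + β * term B k ∎
    ... | no k≢j with j′ , j′<n , eq ← punchInℕ-preimage k<n j<n k≢j = begin
        sgn k * M 0 k * detℕ n (minor M k)
      ≡⟨ cong₂ (λ x y → sgn k * x * y) (M≈A 0 k k≢j) minor-linear ⟩
        sgn k * A 0 k * (α * detℕ n (minor A k) + β * detℕ n (minor B k))
      ≡⟨ distrib₂ α β (sgn k) (A 0 k) _ _ ⟩
        α * term A k + β * (sgn k * A 0 k * detℕ n (minor B k))
      ≡⟨ cong (λ x → α * term A k + β * (sgn k * x * detℕ n (minor B k))) (sym (B≈A 0 k k≢j)) ⟩
        α * term A k + β * term B k ∎
      where
      off : ∀ {b} → b ≢ j′ → punchInℕ k b ≢ j
      off b≢j′ e = b≢j′ (punchInℕ-injective k (trans e (sym eq)))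
      minor-linear : detℕ n (minor M k) ≡ α * detℕ n (minor A k) + β * detℕ n (minor B k)
      minor-linear = detℕ-linear n j′ (minor M k) (minor A k) (minor B k) α β j′<n
        (λ a b b≢j′ → M≈A (suc a) _ (off b≢j′)) (λ a b b≢j′ → B≈A (suc a) _ (off b≢j′))
        (λ a → subst (λ c → M (suc a) c ≡ α * A (suc a) c + β * B (suc a) c) (sym eq) (Mʲ (suc a)))

  col : Matrixℕ → ℕ → ℕ → ℤ
  col M j a = M a j

  setCol : Matrixℕ → ℕ → (ℕ → ℤ) → Matrixℕ
  setCol M j v a b = if b ≡ᵇ j then v a else M a b

  setCol-≡ : ∀ M j v a → setCol M j v a j ≡ v a
  setCol-≡ M j v a rewrite ≡ᵇ-refl j = refl

  setCol-≢ : ∀ M j v a {b} → b ≢ j → setCol M j v a b ≡ M a b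
  setCol-≢ M j v a b≢j rewrite ≢⇒≡ᵇ-false b≢j = refl

  detℕ-additive : ∀ n j (M A B : Matrixℕ) → j < n →
    (∀ a b → b ≢ j → M a b ≡ A a b) → (∀ a b → b ≢ j → B a b ≡ A a b) →
    (∀ a → M a j ≡ A a j + B a j) → detℕ n M ≡ detℕ n A + detℕ n B
  detℕ-additive n j M A B j<n M≈A B≈A Mʲ =
    trans (detℕ-linear n j M A B (+ 1) (+ 1) j<n M≈A B≈A λ a →
             trans (Mʲ a) (sym (cong₂ _+_ (ℤP.*-identityˡ (A a j)) (ℤP.*-identityˡ (B a j)))))
          (cong₂ _+_ (ℤP.*-identityˡ (detℕ n A)) (ℤP.*-identityˡ (detℕ n B)))

  detℕ-scaleCol : ∀ n j (M A : Matrixℕ) s → j < n →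
    (∀ a b → b ≢ j → M a b ≡ A a b) → (∀ a → M a j ≡ s * A a j) → detℕ n M ≡ s * detℕ n A
  detℕ-scaleCol n j M A s j<n M≈A Mʲ =
    trans (detℕ-linear n j M A A s (+ 0) j<n M≈A (λ _ _ _ → refl) λ a →
             trans (Mʲ a) (sym (ℤP.+-identityʳ (s * A a j))))
          (ℤP.+-identityʳ (s * detℕ n A))

  detℕ-adjacentEqualCols : ∀ n (M : Matrixℕ) j → suc j < n → (∀ a → M a j ≡ M a (suc j)) → detℕ n M ≡ + 0
  detℕ-adjacentEqualCols (suc n) M j sj<n Mʲ≡Mʲ⁺¹ = sumℕ-pair (suc n) j term sj<n pair-cancels rest-vanishes
    where
    term : ℕ → ℤ
    term k = sgn k * M 0 k * detℕ n (minor M k)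
    cancel : ∀ s x d → s * x * d + - s * x * d ≡ + 0
    cancel = solve-∀
    pair-cancels : term j + term (suc j) ≡ + 0
    pair-cancels = begin
        sgn j * M 0 j * detℕ n (minor M j) + - sgn j * M 0 (suc j) * detℕ n (minor M (suc j))
      ≡⟨ cong₂ (λ x d → sgn j * M 0 j * detℕ n (minor M j) + - sgn j * x * d) (sym (Mʲ≡Mʲ⁺¹ 0))
           (detℕ-cong n (λ a b _ _ → sym (punchInℕ-adjacent (M (suc a)) j b (Mʲ≡Mʲ⁺¹ (suc a))))) ⟩
        sgn j * M 0 j * detℕ n (minor M j) + - sgn j * M 0 j * detℕ n (minor M j)
      ≡⟨ cancel (sgn j) (M 0 j) _ ⟩
        + 0 ∎
    rest-vanishes : ∀ k → k < suc n → k ≢ j → k ≢ suc j → term k ≡ + 0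
    rest-vanishes k k<n k≢j k≢sj
      with j′ , sj′<n , eq₁ , eq₂ ← punchInℕ-adjacentPreimage k j k<n sj<n k≢j k≢sj =
      trans (cong (sgn k * M 0 k *_) (detℕ-adjacentEqualCols n (minor M k) j′ sj′<n
              (λ a → trans (cong (M (suc a)) eq₁) (trans (Mʲ≡Mʲ⁺¹ (suc a)) (cong (M (suc a)) (sym eq₂))))))
            (ℤP.*-zeroʳ (sgn k * M 0 k))

  detℕ-swapAdjacentCols : ∀ n (M : Matrixℕ) j → suc j < n →
    detℕ n (setCol (setCol M (suc j) (col M j)) j (col M (suc j))) ≡ - detℕ n M
  detℕ-swapAdjacentCols n M j sj<n = trans (x+y≡z⇒y≡z-x (detℕ n M) (detℕ n (X v u)) (+ 0) (begin
      detℕ n M + detℕ n (X v u)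
    ≡⟨ cong₂ _+_ (trans (sym (detℕ-cong n (λ a b _ _ → X-restores a b))) (sym (ℤP.+-identityˡ _)))
                 (sym (ℤP.+-identityʳ _)) ⟩
      (+ 0 + detℕ n (X u v)) + (detℕ n (X v u) + + 0)
    ≡⟨ cong₂ (λ x y → (x + detℕ n (X u v)) + (detℕ n (X v u) + y)) (sym (X-equal u)) (sym (X-equal v)) ⟩
      (detℕ n (X u u) + detℕ n (X u v)) + (detℕ n (X v u) + detℕ n (X v v))
    ≡⟨ cong₂ _+_ (sym (additive-sj u)) (sym (additive-sj v)) ⟩
      detℕ n (X u w) + detℕ n (X v w)
    ≡⟨ sym (additive-j w) ⟩
      detℕ n (X w w)
    ≡⟨ X-equal w ⟩
      + 0 ∎)) (ℤP.+-identityˡ (- detℕ n M))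
    where
    u v w : ℕ → ℤ
    u = col M j
    v = col M (suc j)
    w a = u a + v a
    j<n : j < n
    j<n = ℕP.<-trans (ℕP.n<1+n j) sj<n
    sj≢j : suc j ≢ j
    sj≢j = ℕP.1+n≢n
    X : (ℕ → ℤ) → (ℕ → ℤ) → Matrixℕ
    X p q = setCol (setCol M (suc j) q) j p
    X-j : ∀ p q a → X p q a j ≡ p a
    X-j p q = setCol-≡ (setCol M (suc j) q) j p
    X-sj : ∀ p q a → X p q a (suc j) ≡ q a
    X-sj p q a = trans (setCol-≢ (setCol M (suc j) q) j p a sj≢j) (setCol-≡ M (suc j) q a)
    X-off : ∀ p q a {b} → b ≢ j → b ≢ suc j → X p q a b ≡ M a b
    X-off p q a b≢j b≢sj = trans (setCol-≢ (setCol M (suc j) q) j p a b≢j) (setCol-≢ M (suc j) q a b≢sj)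
    X-restores : ∀ a b → X u v a b ≡ M a b
    X-restores a b with b ℕP.≟ j | b ℕP.≟ suc j
    ... | yes refl | _        = X-j u v a
    ... | no _     | yes refl = X-sj u v a
    ... | no b≢j   | no b≢sj  = X-off u v a b≢j b≢sj
    X-equal : ∀ p → detℕ n (X p p) ≡ + 0
    X-equal p = detℕ-adjacentEqualCols n (X p p) j sj<n (λ a → trans (X-j p p a) (sym (X-sj p p a)))
    additive-j : ∀ q → detℕ n (X w q) ≡ detℕ n (X u q) + detℕ n (X v q)
    additive-j q = detℕ-additive n j (X w q) (X u q) (X v q) j<n
      (λ a b b≢j → trans (setCol-≢ Mq j w a b≢j) (sym (setCol-≢ Mq j u a b≢j)))
      (λ a b b≢j → trans (setCol-≢ Mq j v a b≢j) (sym (setCol-≢ Mq j u a b≢j)))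
      (λ a → trans (X-j w q a) (sym (cong₂ _+_ (X-j u q a) (X-j v q a))))
      where
      Mq : Matrixℕ
      Mq = setCol M (suc j) q
    additive-sj : ∀ p → detℕ n (X p w) ≡ detℕ n (X p u) + detℕ n (X p v)
    additive-sj p = detℕ-additive n (suc j) (X p w) (X p u) (X p v) sj<n off off
      (λ a → trans (X-sj p w a) (sym (cong₂ _+_ (X-sj p u a) (X-sj p v a))))
      where
      off : ∀ {q q′} a b → b ≢ suc j → X p q a b ≡ X p q′ a b
      off {q} {q′} a b b≢sj with b ℕP.≟ j
      ... | yes refl = trans (X-j p q a) (sym (X-j p q′ a))
      ... | no b≢j   = trans (X-off p q a b≢j b≢sj) (sym (X-off p q′ a b≢j b≢sj))

  detℕ-equalCols : ∀ n (M : Matrixℕ) i j → i < j → j < n → (∀ a → M a i ≡ M a j) → detℕ n M ≡ + 0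
  detℕ-equalCols n M i (suc j) i<sj sj<n Mⁱ≡Mʲ with i ℕP.≟ j
  ... | yes refl = detℕ-adjacentEqualCols n M i sj<n Mⁱ≡Mʲ
  ... | no i≢j   = ℤP.neg-injective (begin
      - detℕ n M
    ≡⟨ sym (detℕ-swapAdjacentCols n M j sj<n) ⟩
      detℕ n M′
    ≡⟨ detℕ-equalCols n M′ i j (ℕP.≤∧≢⇒< (ℕP.≤-pred i<sj) i≢j) (ℕP.<-trans (ℕP.n<1+n j) sj<n)
                                M′ⁱ≡M′ʲ ⟩
      + 0 ∎)
    where
    M′ : Matrixℕ
    M′ = setCol (setCol M (suc j) (col M j)) j (col M (suc j))
    M′ⁱ≡M′ʲ : ∀ a → M′ a i ≡ M′ a j
    M′ⁱ≡M′ʲ a = begin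
      M′ a i     ≡⟨ setCol-≢ (setCol M (suc j) (col M j)) j (col M (suc j)) a i≢j ⟩
      setCol M (suc j) (col M j) a i ≡⟨ setCol-≢ M (suc j) (col M j) a (ℕP.<⇒≢ i<sj) ⟩
      M a i      ≡⟨ Mⁱ≡Mʲ a ⟩
      M a (suc j) ≡⟨ sym (setCol-≡ (setCol M (suc j) (col M j)) j (col M (suc j)) a) ⟩
      M′ a j     ∎

  detℕ-equalCols′ : ∀ n (M : Matrixℕ) i j → i ≢ j → i < n → j < n → (∀ a → M a i ≡ M a j) →
    detℕ n M ≡ + 0
  detℕ-equalCols′ n M i j i≢j i<n j<n Mⁱ≡Mʲ with ℕP.<-cmp i j
  ... | tri< i<j _ _ = detℕ-equalCols n M i j i<j j<n Mⁱ≡Mʲ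
  ... | tri≈ _ i≡j _ = contradiction i≡j i≢j
  ... | tri> _ _ j<i = detℕ-equalCols n M j i j<i i<n (sym ∘ Mⁱ≡Mʲ)

  detℕ-addCol : ∀ n (M : Matrixℕ) i j α → i ≢ j → i < n → j < n →
    detℕ n (setCol M j (λ a → M a j + α * M a i)) ≡ detℕ n M
  detℕ-addCol n M i j α i≢j i<n j<n = begin
      detℕ n (setCol M j (λ a → M a j + α * M a i))
    ≡⟨ detℕ-linear n j (setCol M j v) M (setCol M j (col M i)) (+ 1) α j<n
         (λ a b b≢j → setCol-≢ M j v a b≢j) (λ a b b≢j → setCol-≢ M j (col M i) a b≢j)
         (λ a → trans (setCol-≡ M j v a)
                  (cong₂ (λ x y → x + α * y) (sym (ℤP.*-identityˡ (M a j))) (sym (setCol-≡ M j (col M i) a)))) ⟩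
      + 1 * detℕ n M + α * detℕ n (setCol M j (col M i))
    ≡⟨ cong₂ (λ x y → x + α * y) (ℤP.*-identityˡ (detℕ n M))
         (detℕ-equalCols′ n (setCol M j (col M i)) i j i≢j i<n j<n
            (λ a → trans (setCol-≢ M j (col M i) a i≢j) (sym (setCol-≡ M j (col M i) a)))) ⟩
      detℕ n M + α * + 0
    ≡⟨ cong (λ x → detℕ n M + x) (ℤP.*-zeroʳ α) ⟩
      detℕ n M + + 0
    ≡⟨ ℤP.+-identityʳ (detℕ n M) ⟩
      detℕ n M ∎
    where
    v : ℕ → ℤ
    v a = M a j + α * M a i

  unitCol0 : Matrixℕ → Matrixℕ
  unitCol0 M a zero    = + 1
  unitCol0 M a (suc b) = M a (suc b)

  detℕ-rowSums : ∀ n (M : Matrixℕ) s → (∀ a → a < suc n → sumℕ (suc n) (M a) ≡ s) →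
    detℕ (suc n) M ≡ s * detℕ (suc n) (unitCol0 M)
  detℕ-rowSums n M s rowSum = begin
      detℕ (suc n) M
    ≡⟨ sym (det-partial n ℕP.≤-refl) ⟩
      detℕ (suc n) (partial n)
    ≡⟨ detℕ-cong (suc n) (λ a b a<n _ → cong (λ x → if b ≡ᵇ 0 then x else M a b) (rowSum a a<n)) ⟩
      detℕ (suc n) (setCol M 0 (λ _ → s))
    ≡⟨ detℕ-scaleCol (suc n) 0 _ (unitCol0 M) s (s≤s z≤n) off-col0 (λ a → sym (ℤP.*-identityʳ s)) ⟩
      s * detℕ (suc n) (unitCol0 M) ∎
    where
    partial : ℕ → Matrixℕ
    partial k = setCol M 0 (λ a → sumℕ (suc k) (M a))
    off-col0 : ∀ a b → b ≢ 0 → setCol M 0 (λ _ → s) a b ≡ unitCol0 M a b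
    off-col0 a zero    b≢0 = contradiction refl b≢0
    off-col0 a (suc b) _   = refl
    partial-step : ∀ k a b →
      partial (suc k) a b ≡ setCol (partial k) 0 (λ a → partial k a 0 + + 1 * partial k a (suc k)) a b
    partial-step k a zero    = trans (sumℕ-snoc (suc k) (M a))
      (cong (λ x → sumℕ (suc k) (M a) + x) (sym (ℤP.*-identityˡ (M a (suc k)))))
    partial-step k a (suc b) = refl
    det-partial : ∀ k → k ≤ n → detℕ (suc n) (partial k) ≡ detℕ (suc n) M
    det-partial zero    _   = detℕ-cong (suc n) restore
      where
      restore : ∀ a b → a < suc n → b < suc n → partial 0 a b ≡ M a b
      restore a zero    _ _ = ℤP.+-identityʳ (M a 0)
      restore a (suc b) _ _ = refl
    det-partial (suc k) k<n = begin
      detℕ (suc n) (partial (suc k))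
        ≡⟨ detℕ-cong (suc n) (λ a b _ _ → partial-step k a b) ⟩
      detℕ (suc n) (setCol (partial k) 0 (λ a → partial k a 0 + + 1 * partial k a (suc k)))
        ≡⟨ detℕ-addCol (suc n) (partial k) (suc k) 0 (+ 1) (λ ()) (s≤s k<n) (s≤s z≤n) ⟩
      detℕ (suc n) (partial k)
        ≡⟨ det-partial k (ℕP.<⇒≤ k<n) ⟩
      detℕ (suc n) M ∎

  shearCol0 : (ℕ → ℤ) → Matrixℕ → Matrixℕ
  shearCol0 α M a zero    = M a zero
  shearCol0 α M a (suc b) = M a (suc b) + α b * M a zero

  detℕ-shearCol0 : ∀ n α (M : Matrixℕ) → detℕ (suc n) (shearCol0 α M) ≡ detℕ (suc n) M
  detℕ-shearCol0 n α M = begin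
      detℕ (suc n) (shearCol0 α M)
    ≡⟨ detℕ-cong (suc n) complete ⟩
      detℕ (suc n) (partial n)
    ≡⟨ det-partial n ℕP.≤-refl ⟩
      detℕ (suc n) M ∎
    where
    partial : ℕ → Matrixℕ
    partial k a zero    = M a zero
    partial k a (suc b) = if b ℕ.<ᵇ k then M a (suc b) + α b * M a zero else M a (suc b)
    complete : ∀ a b → a < suc n → b < suc n → shearCol0 α M a b ≡ partial n a b
    complete a zero    _ _         = refl
    complete a (suc b) _ (s≤s b<n) rewrite <⇒<ᵇ-true b<n = refl
    partial-step : ∀ k a b →
      partial (suc k) a b ≡ setCol (partial k) (suc k) (λ a → partial k a (suc k) + α k * partial k a 0) a b
    partial-step k a zero    = refl
    partial-step k a (suc b) with b ℕP.≟ k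
    ... | yes refl rewrite <⇒<ᵇ-true (ℕP.n<1+n b) | ≡ᵇ-refl b | ≮⇒<ᵇ-false {b} {b} (ℕP.<-irrefl refl) = refl
    ... | no b≢k   rewrite <ᵇ-suc b≢k | ≢⇒≡ᵇ-false b≢k = refl
    det-partial : ∀ k → k ≤ n → detℕ (suc n) (partial k) ≡ detℕ (suc n) M
    det-partial zero    _   = detℕ-cong (suc n) restore
      where
      restore : ∀ a b → a < suc n → b < suc n → partial 0 a b ≡ M a b
      restore a zero    _ _ = refl
      restore a (suc b) _ _ = refl
    det-partial (suc k) k<n = begin
      detℕ (suc n) (partial (suc k))
        ≡⟨ detℕ-cong (suc n) (λ a b _ _ → partial-step k a b) ⟩
      detℕ (suc n) (setCol (partial k) (suc k) (λ a → partial k a (suc k) + α k * partial k a 0))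
        ≡⟨ detℕ-addCol (suc n) (partial k) 0 (suc k) (α k) (λ ()) (s≤s z≤n) (s≤s k<n) ⟩
      detℕ (suc n) (partial k)
        ≡⟨ det-partial k (ℕP.<⇒≤ k<n) ⟩
      detℕ (suc n) M ∎

  detℕ-sparseRow0 : ∀ n (M : Matrixℕ) → (∀ b → M 0 (suc b) ≡ + 0) →
    detℕ (suc n) M ≡ M 0 0 * detℕ n (minor M 0)
  detℕ-sparseRow0 n M row0 = begin
      + 1 * M 0 0 * detℕ n (minor M 0) + sumℕ n (λ k → sgn (suc k) * M 0 (suc k) * detℕ n (minor M (suc k)))
    ≡⟨ cong₂ _+_ (cong (_* detℕ n (minor M 0)) (ℤP.*-identityˡ (M 0 0)))
         (sumℕ-zero n (λ k _ → trans (cong (λ x → sgn (suc k) * x * detℕ n (minor M (suc k))) (row0 k))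
                                     (trans (cong (_* detℕ n (minor M (suc k))) (ℤP.*-zeroʳ (sgn (suc k))))
                                            (ℤP.*-zeroˡ (detℕ n (minor M (suc k))))))) ⟩
      M 0 0 * detℕ n (minor M 0) + + 0
    ≡⟨ ℤP.+-identityʳ _ ⟩
      M 0 0 * detℕ n (minor M 0) ∎

  detℕ-pivot : ∀ n (M : Matrixℕ) → M 0 0 ≡ + 1 →
    detℕ (suc n) M ≡ detℕ n (λ a b → M (suc a) (suc b) - M (suc a) 0 * M 0 (suc b))
  detℕ-pivot n M M₀₀≡1 = begin
      detℕ (suc n) M
    ≡⟨ sym (detℕ-shearCol0 n α M) ⟩
      detℕ (suc n) (shearCol0 α M)
    ≡⟨ detℕ-sparseRow0 n (shearCol0 α M) row0-cleared ⟩
      M 0 0 * detℕ n (minor (shearCol0 α M) 0)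
    ≡⟨ cong₂ _*_ M₀₀≡1 (detℕ-cong n (λ a b _ _ → condense (M (suc a) (suc b)) (M 0 (suc b)) (M (suc a) 0))) ⟩
      + 1 * detℕ n (λ a b → M (suc a) (suc b) - M (suc a) 0 * M 0 (suc b))
    ≡⟨ ℤP.*-identityˡ _ ⟩
      detℕ n (λ a b → M (suc a) (suc b) - M (suc a) 0 * M 0 (suc b)) ∎
    where
    α : ℕ → ℤ
    α b = - M 0 (suc b)
    cancel : ∀ x → x + - x * + 1 ≡ + 0
    cancel = solve-∀
    condense : ∀ x y z → x + - y * z ≡ x - z * y
    condense = solve-∀
    row0-cleared : ∀ b → shearCol0 α M 0 (suc b) ≡ + 0
    row0-cleared b = trans (cong (λ x → M 0 (suc b) + α b * x) M₀₀≡1) (cancel (M 0 (suc b)))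

  detℕ-lastCol : ∀ n (M : Matrixℕ) → (∀ a → a < n → M a n ≡ + 0) → detℕ (suc n) M ≡ M n n * detℕ n M
  detℕ-lastCol zero    M _       = lemma (M 0 0)
    where
    lemma : ∀ x → + 1 * x * + 1 + + 0 ≡ x * + 1
    lemma = solve-∀
  detℕ-lastCol (suc n) M lastCol = begin
      sumℕ (suc (suc n)) term
    ≡⟨ sumℕ-snoc (suc n) term ⟩
      sumℕ (suc n) term + term (suc n)
    ≡⟨ cong₂ _+_ (sumℕ-cong (suc n) expand-minor) last-term ⟩
      sumℕ (suc n) (λ k → m * (sgn k * M 0 k * detℕ n (minor M k))) + + 0
    ≡⟨ ℤP.+-identityʳ _ ⟩
      sumℕ (suc n) (λ k → m * (sgn k * M 0 k * detℕ n (minor M k)))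
    ≡⟨ sumℕ-*ˡ (suc n) m (λ k → sgn k * M 0 k * detℕ n (minor M k)) ⟩
      m * detℕ (suc n) M ∎
    where
    m : ℤ
    m = M (suc n) (suc n)
    term : ℕ → ℤ
    term k = sgn k * M 0 k * detℕ (suc n) (minor M k)
    commute : ∀ s x m d → s * x * (m * d) ≡ m * (s * x * d)
    commute = solve-∀
    last-term : term (suc n) ≡ + 0
    last-term = begin
      sgn (suc n) * M 0 (suc n) * d  ≡⟨ cong (λ x → sgn (suc n) * x * d) (lastCol 0 (s≤s z≤n)) ⟩
      sgn (suc n) * + 0 * d          ≡⟨ cong (_* d) (ℤP.*-zeroʳ (sgn (suc n))) ⟩
      + 0 * d                        ≡⟨ ℤP.*-zeroˡ d ⟩
      + 0                            ∎
      where
      d = detℕ (suc n) (minor M (suc n))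
    expand-minor : ∀ k → k < suc n → term k ≡ m * (sgn k * M 0 k * detℕ n (minor M k))
    expand-minor k (s≤s k≤n) = trans (cong (sgn k * M 0 k *_) (trans
        (detℕ-lastCol n (minor M k) λ a a<n →
           trans (cong (M (suc a)) (punchInℕ-≥ k≤n)) (lastCol (suc a) (s≤s a<n)))
        (cong (λ x → M (suc n) x * detℕ n (minor M k)) (punchInℕ-≥ k≤n))))
      (commute (sgn k) (M 0 k) m (detℕ n (minor M k)))

  -- The threshold graph

  thresholdAdj : ℕ → ℕ → ℕ → Bool
  thresholdAdj K a b = not (a ≡ᵇ b) ∧ (a ℕ.+ b ≤ᵇ K)

  thresholdAdj-sym : ∀ K a b → thresholdAdj K a b ≡ thresholdAdj K b a
  thresholdAdj-sym K a b =
    cong₂ (λ δ s → not δ ∧ (s ≤ᵇ K))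
          (reflects-≡ (≡ᵇ-reflects a b) (≡ᵇ-reflects b a) sym sym) (ℕP.+-comm a b)

  labelsClose : ∀ k₁ m₁ k₂ m₂ →
    and (zipWith close (replicate k₁ 1 ++ replicate m₁ 2) (replicate k₂ 1 ++ replicate m₂ 2)) ≡ true
  labelsClose zero     zero     _        _        = refl
  labelsClose (suc k₁) m₁       zero     zero     = refl
  labelsClose zero     (suc m₁) zero     zero     = refl
  labelsClose (suc k₁) m₁       (suc k₂) m₂       = labelsClose k₁ m₁ k₂ m₂
  labelsClose (suc k₁) m₁       zero     (suc m₂) = labelsClose k₁ m₁ zero m₂
  labelsClose zero     (suc m₁) (suc k₂) m₂       = labelsClose zero m₁ k₂ m₂
  labelsClose zero     (suc m₁) zero     (suc m₂) = labelsClose zero m₁ zero m₂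

  adjG-twos : ∀ m → adjG (replicate m 2) (replicate m 2) ≡ false
  adjG-twos zero    = refl
  adjG-twos (suc m) = adjG-twos m

  adjG-labels : ∀ k₁ m₁ k₂ m₂ → k₁ ℕ.+ m₁ ≡ k₂ ℕ.+ m₂ →
    adjG (replicate k₁ 1 ++ replicate m₁ 2) (replicate k₂ 1 ++ replicate m₂ 2) ≡ not (k₁ ≡ᵇ k₂)
  adjG-labels (suc k₁) m₁       (suc k₂) m₂       eq   = adjG-labels k₁ m₁ k₂ m₂ (ℕP.suc-injective eq)
  adjG-labels zero     m₁       zero     m₂       refl = adjG-twos m₁
  adjG-labels zero     (suc m₁) (suc k₂) m₂       _    = labelsClose zero m₁ k₂ m₂
  adjG-labels (suc k₁) m₁       zero     (suc m₂) _    = labelsClose k₁ m₁ zero m₂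
  adjG-labels zero     zero     (suc k₂) m₂       ()
  adjG-labels (suc k₁) m₁       zero     zero     ()

  numOnes-label : ∀ k m → numOnes (replicate k 1 ++ replicate m 2) ≡ k
  numOnes-label (suc k) m       = cong suc (numOnes-label k m)
  numOnes-label zero    zero    = refl
  numOnes-label zero    (suc m) = numOnes-label zero m

  ∸≤∸⇔+≤ : ∀ {a b c} → a ≤ c → c ≤ b → (b ∸ c ≤ c ∸ a ⇔ a ℕ.+ b ≤ 2 ℕ.* c)
  ∸≤∸⇔+≤ {a} a≤c c≤b
    with d , refl ← ℕP.m≤n⇒∃[o]m+o≡n a≤c | e , refl ← ℕP.m≤n⇒∃[o]m+o≡n c≤b
    rewrite ℕP.m+n∸m≡n (a ℕ.+ d) e | ℕP.m+n∸m≡n a d = mk⇔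
      (λ e≤d → subst₂ _≤_ (sym (lhs a d e)) (sym (rhs a d)) (ℕP.+-monoʳ-≤ (a ℕ.+ a ℕ.+ d) e≤d))
      (λ ≤2c → ℕP.+-cancelˡ-≤ (a ℕ.+ a ℕ.+ d) e d (subst₂ _≤_ (lhs a d e) (rhs a d) ≤2c))
    where
    lhs : ∀ a d e → a ℕ.+ (a ℕ.+ d ℕ.+ e) ≡ a ℕ.+ a ℕ.+ d ℕ.+ e
    lhs = NS.solve-∀
    rhs : ∀ a d → 2 ℕ.* (a ℕ.+ d) ≡ a ℕ.+ a ℕ.+ d ℕ.+ d
    rhs = NS.solve-∀

  thresholdAdj-across : ∀ c a b → a ≤ c → c < b → (b ∸ c ≤ᵇ c ∸ a) ≡ thresholdAdj (2 ℕ.* c) a b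
  thresholdAdj-across c a b a≤c c<b = begin
      (b ∸ c ≤ᵇ c ∸ a)
    ≡⟨ reflects-≡ (ℕP.≤ᵇ-reflects-≤ _ _) (ℕP.≤ᵇ-reflects-≤ _ _)
                  (Equivalence.to arith) (Equivalence.from arith) ⟩
      (a ℕ.+ b ≤ᵇ 2 ℕ.* c)
    ≡⟨ cong (λ δ → not δ ∧ (a ℕ.+ b ≤ᵇ 2 ℕ.* c))
            (sym (≢⇒≡ᵇ-false (ℕP.<⇒≢ (ℕP.≤-<-trans a≤c c<b)))) ⟩
      thresholdAdj (2 ℕ.* c) a b ∎
    where
    arith = ∸≤∸⇔+≤ a≤c (ℕP.<⇒≤ c<b)

  adjPlusℕ≡thresholdAdj : ∀ c a b → adjPlusℕ c a b ≡ thresholdAdj (2 ℕ.* c) a b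
  adjPlusℕ≡thresholdAdj c a b with a ≤ᵇ c | ℕP.≤ᵇ-reflects-≤ a c | b ≤ᵇ c | ℕP.≤ᵇ-reflects-≤ b c
  ... | true  | ofʸ a≤c | true  | ofʸ b≤c = begin
      adjG (label c a) (label c b)
    ≡⟨ adjG-labels (c ∸ a) a (c ∸ b) b (trans (ℕP.m∸n+n≡m a≤c) (sym (ℕP.m∸n+n≡m b≤c))) ⟩
      not (c ∸ a ≡ᵇ c ∸ b)
    ≡⟨ cong not (reflects-≡ (≡ᵇ-reflects _ _) (≡ᵇ-reflects a b)
                            (ℕP.∸-cancelˡ-≡ a≤c b≤c) (cong (c ∸_))) ⟩
      not (a ≡ᵇ b)
    ≡⟨ sym (∧-identityʳ (not (a ≡ᵇ b))) ⟩
      not (a ≡ᵇ b) ∧ true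
    ≡⟨ cong (not (a ≡ᵇ b) ∧_)
            (sym (≤⇒≤ᵇ-true (ℕP.+-mono-≤ a≤c (ℕP.≤-trans b≤c (ℕP.m≤m+n c 0))))) ⟩
      thresholdAdj (2 ℕ.* c) a b ∎
  ... | true  | ofʸ a≤c | false | ofⁿ b≰c =
    trans (cong (b ∸ c ≤ᵇ_) (numOnes-label (c ∸ a) a)) (thresholdAdj-across c a b a≤c (ℕP.≰⇒> b≰c))
  ... | false | ofⁿ a≰c | true  | ofʸ b≤c =
    trans (cong (a ∸ c ≤ᵇ_) (numOnes-label (c ∸ b) b))
          (trans (thresholdAdj-across c b a b≤c (ℕP.≰⇒> a≰c)) (thresholdAdj-sym (2 ℕ.* c) b a))
  ... | false | ofⁿ a≰c | false | ofⁿ b≰c =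
    sym (trans (cong (not (a ≡ᵇ b) ∧_) (≰⇒≤ᵇ-false (ℕP.<⇒≱ 2c<a+b))) (∧-zeroʳ (not (a ≡ᵇ b))))
    where
    2c<a+b : 2 ℕ.* c < a ℕ.+ b
    2c<a+b = ℕP.+-mono-≤-< (ℕP.<⇒≤ (ℕP.≰⇒> a≰c))
                            (ℕP.≤-<-trans (ℕP.≤-reflexive (ℕP.+-identityʳ c)) (ℕP.≰⇒> b≰c))

  edge : ℕ → Matrixℕ
  edge K a b = if thresholdAdj K a b then + 1 else + 0

  deg : ℕ → ℕ → ℤ
  deg K a = sumℕ (suc K) (edge K a)

  laplacianℕ : ℕ → Matrixℕ
  laplacianℕ K a b = (if a ≡ᵇ b then deg K a else + 0) - edge K a b

  2c+1≡1+2c : ∀ c → 2 ℕ.* c ℕ.+ 1 ≡ suc (2 ℕ.* c)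
  2c+1≡1+2c c = ℕP.+-comm (2 ℕ.* c) 1

  L⁺≡laplacianℕ : ∀ c (i j : Fin (2 ℕ.* c ℕ.+ 1)) → L⁺ c i j ≡ laplacianℕ (2 ℕ.* c) (toℕ i) (toℕ j)
  L⁺≡laplacianℕ c i j = cong₂ (λ d e → (if toℕ i ≡ᵇ toℕ j then d else + 0) - e) degree≡deg (edge≡ j)
    where
    edge≡ : ∀ j → (if adjPlus c i j then + 1 else + 0) ≡ edge (2 ℕ.* c) (toℕ i) (toℕ j)
    edge≡ j = cong (λ b → if b then + 1 else + 0) (adjPlusℕ≡thresholdAdj c (toℕ i) (toℕ j))
    degree≡deg : degree (adjPlus c) i ≡ deg (2 ℕ.* c) (toℕ i)
    degree≡deg = trans (∑≡sumℕ _ (edge (2 ℕ.* c) (toℕ i)) edge≡)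
                       (cong (λ n → sumℕ n (edge (2 ℕ.* c) (toℕ i))) (2c+1≡1+2c c))

  edge-shift : ∀ K a b → edge (suc (suc K)) (suc a) (suc b) ≡ edge K a b
  edge-shift K a b rewrite ℕP.+-suc a b | ≤ᵇ-suc (suc (a ℕ.+ b)) (suc K) | ≤ᵇ-suc (a ℕ.+ b) K = refl

  edge-from0 : ∀ K b → suc b ≤ K → edge K 0 (suc b) ≡ + 1
  edge-from0 K b sb≤K rewrite ≤⇒≤ᵇ-true sb≤K = refl

  edge-to0 : ∀ K a → suc a ≤ K → edge K (suc a) 0 ≡ + 1
  edge-to0 K a sa≤K rewrite ℕP.+-identityʳ a | ≤⇒≤ᵇ-true sa≤K = refl

  edge-near : ∀ K a b → a ≢ b → a ℕ.+ b ≤ K → edge K a b ≡ + 1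
  edge-near K a b a≢b a+b≤K rewrite ≢⇒≡ᵇ-false a≢b | ≤⇒≤ᵇ-true a+b≤K = refl

  edge-far : ∀ K a b → K < a ℕ.+ b → edge K a b ≡ + 0
  edge-far K a b K<a+b rewrite ≰⇒≤ᵇ-false (ℕP.<⇒≱ K<a+b) | ∧-zeroʳ (not (a ≡ᵇ b)) = refl

  deg-shift : ∀ K a → a ≤ K → deg (suc (suc K)) (suc a) ≡ + 1 + deg K a
  deg-shift K a a≤K = begin
      edge (suc (suc K)) (suc a) 0 + sumℕ (suc (suc K)) (λ b → edge (suc (suc K)) (suc a) (suc b))
    ≡⟨ cong₂ _+_ (edge-to0 (suc (suc K)) a (s≤s (ℕP.m≤n⇒m≤1+n a≤K)))
                 (sumℕ-cong (suc (suc K)) (λ b _ → edge-shift K a b)) ⟩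
      + 1 + sumℕ (suc (suc K)) (edge K a)
    ≡⟨ cong (λ x → + 1 + x) (sumℕ-snoc (suc K) (edge K a)) ⟩
      + 1 + (deg K a + edge K a (suc K))
    ≡⟨ cong (λ x → + 1 + (deg K a + x)) (edge-far K a (suc K) (ℕP.≤-trans (ℕP.n<1+n K) (ℕP.m≤n+m (suc K) a))) ⟩
      + 1 + (deg K a + + 0)
    ≡⟨ cong (λ x → + 1 + x) (ℤP.+-identityʳ (deg K a)) ⟩
      + 1 + deg K a ∎

  deg-pendant : ∀ K → deg (suc (suc K)) (suc (suc K)) ≡ + 1
  deg-pendant K = cong₂ _+_ (edge-to0 (suc (suc K)) (suc K) ℕP.≤-refl)
    (sumℕ-zero (suc (suc K)) (λ b _ → edge-far (suc (suc K)) (suc (suc K)) (suc b) (ℕP.m<m+n (suc (suc K)) (s≤s z≤n))))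

  laplacianℕ-rowSum : ∀ K a → a ≤ K → sumℕ (suc K) (laplacianℕ K a) ≡ + 0
  laplacianℕ-rowSum K a a≤K = begin
      sumℕ (suc K) (laplacianℕ K a)
    ≡⟨ sumℕ-sub (suc K) (λ b → if a ≡ᵇ b then deg K a else + 0) (edge K a) ⟩
      sumℕ (suc K) (λ b → if a ≡ᵇ b then deg K a else + 0) - deg K a
    ≡⟨ cong (_- deg K a) (sumℕ-δ (suc K) a (deg K a) (s≤s a≤K)) ⟩
      deg K a - deg K a
    ≡⟨ ℤP.+-inverseʳ (deg K a) ⟩
      + 0 ∎

  -- The characteristic polynomial

  charMatrix : ℕ → ℤ → Matrixℕ
  charMatrix K t a b = (if a ≡ᵇ b then t else + 0) - laplacianℕ K a b

  charPoly≡detℕ : ∀ c t → charPoly (L⁺ c) t ≡ detℕ (suc (2 ℕ.* c)) (charMatrix (2 ℕ.* c) t)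
  charPoly≡detℕ c t = trans
    (det≡detℕ _ (charMatrix (2 ℕ.* c) t) λ i j →
       cong (λ x → (if toℕ i ≡ᵇ toℕ j then t else + 0) - x) (L⁺≡laplacianℕ c i j))
    (cong (λ n → detℕ n (charMatrix (2 ℕ.* c) t)) (2c+1≡1+2c c))

  charMatrix-rowSum : ∀ K t a → a ≤ K → sumℕ (suc K) (charMatrix K t a) ≡ t
  charMatrix-rowSum K t a a≤K = begin
      sumℕ (suc K) (charMatrix K t a)
    ≡⟨ sumℕ-sub (suc K) (λ b → if a ≡ᵇ b then t else + 0) (laplacianℕ K a) ⟩
      sumℕ (suc K) (λ b → if a ≡ᵇ b then t else + 0) - sumℕ (suc K) (laplacianℕ K a)
    ≡⟨ cong₂ _-_ (sumℕ-δ (suc K) a t (s≤s a≤K)) (laplacianℕ-rowSum K a a≤K) ⟩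
      t - + 0
    ≡⟨ ℤP.+-identityʳ t ⟩
      t ∎

  charMatrix-offDiag : ∀ K t {a b} → a ≢ b → charMatrix K t a b ≡ edge K a b
  charMatrix-offDiag K t {a} {b} a≢b = trans
    (cong (λ δ → (if δ then t else + 0) - ((if δ then deg K a else + 0) - edge K a b)) (≢⇒≡ᵇ-false a≢b))
    (lemma (edge K a b))
    where
    lemma : ∀ e → + 0 - (+ 0 - e) ≡ e
    lemma = solve-∀

  charMatrix-shift : ∀ K t a b → a ≤ K → charMatrix (suc (suc K)) t (suc a) (suc b) ≡ charMatrix K (t - + 1) a b
  charMatrix-shift K t a b a≤K rewrite deg-shift K a a≤K | edge-shift K a b = by-cases (a ≡ᵇ b)
    where
    regroup : ∀ t d e → t - ((+ 1 + d) - e) ≡ (t - + 1) - (d - e)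
    regroup = solve-∀
    by-cases : ∀ δ → (if δ then t else + 0) - ((if δ then + 1 + deg K a else + 0) - edge K a b)
                   ≡ (if δ then t - + 1 else + 0) - ((if δ then deg K a else + 0) - edge K a b)
    by-cases true  = regroup t (deg K a) (edge K a b)
    by-cases false = refl

  charPoly/t : ℕ → ℤ → ℤ
  charPoly/t K t = detℕ (suc K) (unitCol0 (charMatrix K t))

  detℕ-charMatrix : ∀ K t → detℕ (suc K) (charMatrix K t) ≡ t * charPoly/t K t
  detℕ-charMatrix K t = detℕ-rowSums K (charMatrix K t) t (λ a a<K → charMatrix-rowSum K t a (ℕP.≤-pred a<K))

  charPoly/t-step : ∀ K t → charPoly/t (suc (suc K)) t ≡ ((t - + 1) - + suc (suc K)) * ((t - + 1) * charPoly/t K (t - + 1))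
  charPoly/t-step K t = begin
      detℕ (suc n) (unitCol0 M)
    ≡⟨ detℕ-pivot n (unitCol0 M) refl ⟩
      detℕ n (λ a b → M (suc a) (suc b) - + 1 * M 0 (suc b))
    ≡⟨ detℕ-cong n (λ a b _ b<n → cong (λ x → M (suc a) (suc b) - + 1 * x)
                                        (trans (charMatrix-offDiag n t {0} {suc b} (λ ())) (edge-from0 n b b<n))) ⟩
      detℕ n C
    ≡⟨ detℕ-rowSums (suc K) C σ C-rowSum ⟩
      σ * detℕ n (unitCol0 C)
    ≡⟨ cong (σ *_) (sym (detℕ-shearCol0 (suc K) (λ _ → + 1) (unitCol0 C))) ⟩
      σ * detℕ n (shearCol0 (λ _ → + 1) (unitCol0 C))
    ≡⟨ cong (σ *_) (detℕ-cong n (λ a b _ _ → unshear a b)) ⟩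
      σ * detℕ n (unitCol0 B)
    ≡⟨ cong (σ *_) (detℕ-lastCol (suc K) (unitCol0 B) pendant-col) ⟩
      σ * (M n n * detℕ (suc K) (unitCol0 B))
    ≡⟨ cong (λ x → σ * (x * detℕ (suc K) (unitCol0 B))) pendant-diag ⟩
      σ * ((t - + 1) * detℕ (suc K) (unitCol0 B))
    ≡⟨ cong (λ x → σ * ((t - + 1) * x)) (detℕ-cong (suc K) (λ a b a<K _ → restrict a b (ℕP.≤-pred a<K))) ⟩
      σ * ((t - + 1) * charPoly/t K (t - + 1)) ∎
    where
    n = suc (suc K)
    σ = (t - + 1) - + n
    M B C : Matrixℕ
    M = charMatrix n t
    B a b = M (suc a) (suc b)
    C a b = B a b - + 1
    C-rowSum : ∀ a → a < n → sumℕ n (C a) ≡ σ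
    C-rowSum a a<n = begin
        sumℕ n (C a)
      ≡⟨ sumℕ-sub n (B a) (λ _ → + 1) ⟩
        sumℕ n (B a) - sumℕ n (λ _ → + 1)
      ≡⟨ cong₂ _-_ B-rowSum (trans (sumℕ-const n (+ 1)) (ℤP.*-identityʳ (+ n))) ⟩
        σ ∎
      where
      M₀ : M (suc a) 0 ≡ + 1
      M₀ = trans (charMatrix-offDiag n t {suc a} {0} (λ ())) (edge-to0 n a a<n)
      B-rowSum : sumℕ n (B a) ≡ t - + 1
      B-rowSum = x+y≡z⇒y≡z-x (+ 1) (sumℕ n (B a)) t
        (trans (cong (_+ sumℕ n (B a)) (sym M₀)) (charMatrix-rowSum n t (suc a) a<n))
    unshear : ∀ a b → shearCol0 (λ _ → + 1) (unitCol0 C) a b ≡ unitCol0 B a b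
    unshear a zero    = refl
    unshear a (suc b) = lemma (B a (suc b))
      where
      lemma : ∀ x → (x - + 1) + + 1 * + 1 ≡ x
      lemma = solve-∀
    pendant-col : ∀ a → a < suc K → unitCol0 B a (suc K) ≡ + 0
    pendant-col a a<K = trans (charMatrix-offDiag n t (ℕP.<⇒≢ (s≤s a<K))) (edge-far n (suc a) n (ℕP.m<n+m n (s≤s z≤n)))
    pendant-diag : M n n ≡ t - + 1
    pendant-diag rewrite ≡ᵇ-refl n | deg-pendant K = refl
    restrict : ∀ a b → a ≤ K → unitCol0 B a b ≡ unitCol0 (charMatrix K (t - + 1)) a b
    restrict a zero    _   = refl
    restrict a (suc b) a≤K = charMatrix-shift K t a (suc b) a≤K

  rootsPoly : List ℕ → ℤ → ℤ
  rootsPoly xs t = prodℤ (map (λ k → t - + k) xs)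

  rootsPoly-++ : ∀ xs ys t → rootsPoly (xs ++ ys) t ≡ rootsPoly xs t * rootsPoly ys t
  rootsPoly-++ []       ys t = sym (ℤP.*-identityˡ (rootsPoly ys t))
  rootsPoly-++ (x ∷ xs) ys t = trans (cong ((t - + x) *_) (rootsPoly-++ xs ys t)) (sym (ℤP.*-assoc (t - + x) _ _))

  t-[1+k]≡t-1-k : ∀ t k → t - + suc k ≡ (t - + 1) - + k
  t-[1+k]≡t-1-k t k = lemma t (+ k)
    where
    lemma : ∀ t x → t - (+ 1 + x) ≡ (t - + 1) - x
    lemma = solve-∀

  rootsPoly-suc : ∀ xs t → rootsPoly (map suc xs) t ≡ rootsPoly xs (t - + 1)
  rootsPoly-suc []       t = refl
  rootsPoly-suc (x ∷ xs) t = cong₂ _*_ (t-[1+k]≡t-1-k t x) (rootsPoly-suc xs t)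

  nonzeroSpectrum : ℕ → List ℕ
  nonzeroSpectrum c = applyUpTo suc c ++ map (λ j → c ℕ.+ 2 ℕ.+ j) (upTo c)

  nonzeroSpectrum-suc : ∀ c → nonzeroSpectrum (suc c) ≡ 1 ∷ (map suc (nonzeroSpectrum c) ++ [ suc c ℕ.+ 2 ℕ.+ c ])
  nonzeroSpectrum-suc c = begin
      applyUpTo suc (suc c) ++ map (λ j → suc c ℕ.+ 2 ℕ.+ j) (upTo (suc c))
    ≡⟨ cong₂ (λ xs ys → 1 ∷ xs ++ map (λ j → suc c ℕ.+ 2 ℕ.+ j) ys)
         (sym (LP.map-applyUpTo suc suc c)) (sym (LP.upTo-∷ʳ c)) ⟩
      1 ∷ (map suc (applyUpTo suc c) ++ map (λ j → suc c ℕ.+ 2 ℕ.+ j) (upTo c ++ [ c ]))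
    ≡⟨ cong (λ ys → 1 ∷ (map suc (applyUpTo suc c) ++ ys)) (LP.map-++ (λ j → suc c ℕ.+ 2 ℕ.+ j) (upTo c) [ c ]) ⟩
      1 ∷ (map suc (applyUpTo suc c) ++ (map (λ j → suc (c ℕ.+ 2 ℕ.+ j)) (upTo c) ++ [ suc c ℕ.+ 2 ℕ.+ c ]))
    ≡⟨ cong (λ ys → 1 ∷ (map suc (applyUpTo suc c) ++ (ys ++ [ suc c ℕ.+ 2 ℕ.+ c ]))) (LP.map-∘ (upTo c)) ⟩
      1 ∷ (map suc (applyUpTo suc c) ++ (map suc (map (λ j → c ℕ.+ 2 ℕ.+ j) (upTo c)) ++ [ suc c ℕ.+ 2 ℕ.+ c ]))
    ≡⟨ cong (1 ∷_) (sym (LP.++-assoc (map suc (applyUpTo suc c)) _ _)) ⟩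
      1 ∷ ((map suc (applyUpTo suc c) ++ map suc (map (λ j → c ℕ.+ 2 ℕ.+ j) (upTo c))) ++ [ suc c ℕ.+ 2 ℕ.+ c ])
    ≡⟨ cong (λ ys → 1 ∷ (ys ++ [ suc c ℕ.+ 2 ℕ.+ c ])) (sym (LP.map-++ suc (applyUpTo suc c) _)) ⟩
      1 ∷ (map suc (nonzeroSpectrum c) ++ [ suc c ℕ.+ 2 ℕ.+ c ]) ∎

  charPoly/t-closedForm : ∀ c t → charPoly/t (2 ℕ.* c) t ≡ rootsPoly (nonzeroSpectrum c) t
  charPoly/t-closedForm zero    t = refl
  charPoly/t-closedForm (suc c) t = begin
      charPoly/t (2 ℕ.* suc c) t
    ≡⟨ cong (λ K → charPoly/t K t) (ℕP.*-suc 2 c) ⟩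
      charPoly/t (suc (suc (2 ℕ.* c))) t
    ≡⟨ charPoly/t-step (2 ℕ.* c) t ⟩
      ((t - + 1) - + suc (suc (2 ℕ.* c))) * ((t - + 1) * charPoly/t (2 ℕ.* c) (t - + 1))
    ≡⟨ cong₂ (λ x y → x * ((t - + 1) * y)) top-root
         (trans (charPoly/t-closedForm c (t - + 1)) (sym (rootsPoly-suc (nonzeroSpectrum c) t))) ⟩
      (t - + (suc c ℕ.+ 2 ℕ.+ c)) * ((t - + 1) * rootsPoly (map suc (nonzeroSpectrum c)) t)
    ≡⟨ regroup (t - + (suc c ℕ.+ 2 ℕ.+ c)) (t - + 1) _ ⟩
      (t - + 1) * (rootsPoly (map suc (nonzeroSpectrum c)) t * ((t - + (suc c ℕ.+ 2 ℕ.+ c)) * + 1))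
    ≡⟨ cong ((t - + 1) *_) (sym (rootsPoly-++ (map suc (nonzeroSpectrum c)) [ suc c ℕ.+ 2 ℕ.+ c ] t)) ⟩
      rootsPoly (1 ∷ (map suc (nonzeroSpectrum c) ++ [ suc c ℕ.+ 2 ℕ.+ c ])) t
    ≡⟨ cong (λ xs → rootsPoly xs t) (sym (nonzeroSpectrum-suc c)) ⟩
      rootsPoly (nonzeroSpectrum (suc c)) t ∎
    where
    regroup : ∀ x y r → x * (y * r) ≡ y * (r * (x * + 1))
    regroup = solve-∀
    top-root : (t - + 1) - + suc (suc (2 ℕ.* c)) ≡ t - + (suc c ℕ.+ 2 ℕ.+ c)
    top-root = trans (sym (t-[1+k]≡t-1-k t _)) (cong (λ k → t - + k) (count c))
      where
      count : ∀ c → suc (suc (suc (2 ℕ.* c))) ≡ suc c ℕ.+ 2 ℕ.+ c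
      count = NS.solve-∀

  charPoly-L⁺ : ∀ c t → charPoly (L⁺ c) t ≡ prodℤ (map (λ k → t - + k) (spectrum c))
  charPoly-L⁺ c t = begin
      charPoly (L⁺ c) t
    ≡⟨ charPoly≡detℕ c t ⟩
      detℕ (suc (2 ℕ.* c)) (charMatrix (2 ℕ.* c) t)
    ≡⟨ detℕ-charMatrix (2 ℕ.* c) t ⟩
      t * charPoly/t (2 ℕ.* c) t
    ≡⟨ cong₂ _*_ (sym (ℤP.+-identityʳ t)) (charPoly/t-closedForm c t) ⟩
      (t - + 0) * rootsPoly (nonzeroSpectrum c) t ∎

  -- Eigenvectors

  -- (L x)ₐ in closed form: the neighbours of a are the b ≠ a below suc K ∸ a.
  laplacianAction : ℕ → (ℕ → ℤ) → ℕ → ℤ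
  laplacianAction K x a = + (suc K ∸ a) * x a - sumℕ (suc K ∸ a) x

  laplacianℕ-action : ∀ K (x : ℕ → ℤ) a → a ≤ K →
    sumℕ (suc K) (λ b → laplacianℕ K a b * x b) ≡ laplacianAction K x a
  laplacianℕ-action K x a a≤K = begin
      sumℕ (suc K) (λ b → laplacianℕ K a b * x b)
    ≡⟨ sumℕ-cong (suc K) (λ b _ → split b) ⟩
      sumℕ (suc K) (λ b → (if a ≡ᵇ b then deg K a * x a else + 0) - edge K a b * x b)
    ≡⟨ sumℕ-sub (suc K) (λ b → if a ≡ᵇ b then deg K a * x a else + 0) (λ b → edge K a b * x b) ⟩
      sumℕ (suc K) (λ b → if a ≡ᵇ b then deg K a * x a else + 0) - sumℕ (suc K) (λ b → edge K a b * x b)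
    ≡⟨ cong (_- sumℕ (suc K) (λ b → edge K a b * x b))
         (trans (sumℕ-δ (suc K) a (deg K a * x a) (s≤s a≤K)) (sym (sumℕ-*ʳ (suc K) (edge K a) (x a)))) ⟩
      sumℕ (suc K) (λ b → edge K a b * x a) - sumℕ (suc K) (λ b → edge K a b * x b)
    ≡⟨ sym (sumℕ-sub (suc K) (λ b → edge K a b * x a) (λ b → edge K a b * x b)) ⟩
      sumℕ (suc K) (λ b → edge K a b * x a - edge K a b * x b)
    ≡⟨ sumℕ-truncate m (suc K) _ (ℕP.m∸n≤m (suc K) a) far ⟩
      sumℕ m (λ b → edge K a b * x a - edge K a b * x b)
    ≡⟨ sumℕ-cong m near ⟩
      sumℕ m (λ b → x a - x b)
    ≡⟨ sumℕ-sub m (λ _ → x a) x ⟩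
      sumℕ m (λ _ → x a) - sumℕ m x
    ≡⟨ cong (_- sumℕ m x) (sumℕ-const m (x a)) ⟩
      laplacianAction K x a ∎
    where
    m = suc K ∸ a
    a≤1+K : a ≤ suc K
    a≤1+K = ℕP.m≤n⇒m≤1+n a≤K
    split : ∀ b → laplacianℕ K a b * x b ≡ (if a ≡ᵇ b then deg K a * x a else + 0) - edge K a b * x b
    split b = trans (lemma (if a ≡ᵇ b then deg K a else + 0) (edge K a b) (x b))
                    (cong (_- edge K a b * x b) (δ-* a b (deg K a) x))
      where
      lemma : ∀ u e y → (u - e) * y ≡ u * y - e * y
      lemma = solve-∀
    far : ∀ b → m ≤ b → b < suc K → edge K a b * x a - edge K a b * x b ≡ + 0
    far b m≤b _ rewrite edge-far K a b (subst (K <_) (ℕP.+-comm b a)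
                                         (subst (_≤ b ℕ.+ a) (ℕP.m∸n+n≡m a≤1+K) (ℕP.+-monoˡ-≤ a m≤b))) =
      lemma (x a) (x b)
      where
      lemma : ∀ y z → + 0 * y - + 0 * z ≡ + 0
      lemma = solve-∀
    near : ∀ b → b < m → edge K a b * x a - edge K a b * x b ≡ x a - x b
    near b b<m with a ℕP.≟ b
    ... | yes refl = lemma (edge K a a) (x a)
      where
      lemma : ∀ e y → e * y - e * y ≡ y - y
      lemma = solve-∀
    ... | no a≢b   rewrite edge-near K a b a≢b
                             (subst (_≤ K) (ℕP.+-comm b a) (ℕP.≤-pred (ℕP.m≤o∸n⇒m+n≤o (suc b) a≤1+K b<m))) =
      lemma (x a) (x b)
      where
      lemma : ∀ y z → + 1 * y - + 1 * z ≡ y - z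
      lemma = solve-∀

  Eigenpair : ℕ → ℤ → (ℕ → ℤ) → Set
  Eigenpair K λ′ x = ∀ a → a ≤ K → laplacianAction K x a ≡ λ′ * x a

  Eigenpair-cong : ∀ {K λ′} {x y : ℕ → ℤ} → (∀ b → x b ≡ y b) → Eigenpair K λ′ y → Eigenpair K λ′ x
  Eigenpair-cong {K} {λ′} {x} {y} x≗y y-eigen a a≤K = begin
      laplacianAction K x a
    ≡⟨ cong₂ (λ u v → + (suc K ∸ a) * u - v) (x≗y a) (sumℕ-cong (suc K ∸ a) (λ b _ → x≗y b)) ⟩
      laplacianAction K y a
    ≡⟨ y-eigen a a≤K ⟩
      λ′ * y a
    ≡⟨ cong (λ′ *_) (sym (x≗y a)) ⟩
      λ′ * x a ∎

  Eigenpair-sum : ∀ {K λ′ x} → Eigenpair K λ′ x → sumℕ (suc K) x ≡ (+ suc K - λ′) * x 0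
  Eigenpair-sum {K} {λ′} {x} x-eigen = begin
      sumℕ (suc K) x
    ≡⟨ lemma (+ suc K * x 0) (sumℕ (suc K) x) ⟩
      + suc K * x 0 - (+ suc K * x 0 - sumℕ (suc K) x)
    ≡⟨ cong (λ y → + suc K * x 0 - y) (x-eigen 0 z≤n) ⟩
      + suc K * x 0 - λ′ * x 0
    ≡⟨ factor (+ suc K) λ′ (x 0) ⟩
      (+ suc K - λ′) * x 0 ∎
    where
    lemma : ∀ u s → s ≡ u - (u - s)
    lemma = solve-∀
    factor : ∀ n l y → n * y - l * y ≡ (n - l) * y
    factor = solve-∀

  shift : (ℕ → ℤ) → ℕ → ℤ
  shift x zero    = + 0
  shift x (suc b) = x b

  Eigenpair-shift : ∀ {K λ′ x} → Eigenpair K λ′ x → x (suc K) ≡ + 0 → sumℕ (suc K) x ≡ + 0 →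
    Eigenpair (suc (suc K)) (+ 1 + λ′) (shift x)
  Eigenpair-shift {K} {λ′} {x} x-eigen x-last x-sum zero _ = begin
      + suc (suc (suc K)) * + 0 - (+ 0 + sumℕ (suc (suc K)) x)
    ≡⟨ cong (λ s → + suc (suc (suc K)) * + 0 - (+ 0 + s)) (trans (sumℕ-snoc (suc K) x) (cong₂ _+_ x-sum x-last)) ⟩
      + suc (suc (suc K)) * + 0 - (+ 0 + (+ 0 + + 0))
    ≡⟨ lemma (+ suc (suc (suc K))) (+ 1 + λ′) ⟩
      (+ 1 + λ′) * + 0 ∎
    where
    lemma : ∀ n l → n * + 0 - (+ 0 + (+ 0 + + 0)) ≡ l * + 0
    lemma = solve-∀
  Eigenpair-shift {K} {λ′} {x} x-eigen x-last x-sum (suc a) (s≤s a≤sK) with a ℕP.≤? K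
  ... | yes a≤K rewrite ℕP.+-∸-assoc 1 a≤sK = begin
      + suc m * x a - (+ 0 + sumℕ m x)
    ≡⟨ lemma₁ (+ m) (x a) (sumℕ m x) ⟩
      x a + laplacianAction K x a
    ≡⟨ cong (λ y → x a + y) (x-eigen a a≤K) ⟩
      x a + λ′ * x a
    ≡⟨ lemma₂ λ′ (x a) ⟩
      (+ 1 + λ′) * x a ∎
    where
    m = suc K ∸ a
    lemma₁ : ∀ m y s → (+ 1 + m) * y - (+ 0 + s) ≡ y + (m * y - s)
    lemma₁ = solve-∀
    lemma₂ : ∀ l y → y + l * y ≡ (+ 1 + l) * y
    lemma₂ = solve-∀
  ... | no a≰K with refl ← ℕP.≤-antisym a≤sK (ℕP.≰⇒> a≰K) rewrite ℕP.m+n∸n≡m 1 K | x-last =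
    lemma (+ 1 + λ′)
    where
    lemma : ∀ l → + 1 * + 0 - (+ 0 + + 0) ≡ l * + 0
    lemma = solve-∀

  Eigenpair-constant : ∀ K → Eigenpair K (+ 0) (λ _ → + 1)
  Eigenpair-constant K a _ = trans (cong (λ s → + (suc K ∸ a) * + 1 - s) (sumℕ-const (suc K ∸ a) (+ 1)))
                                   (trans (ℤP.+-inverseʳ (+ (suc K ∸ a) * + 1)) (sym (ℤP.*-zeroˡ (+ 1))))

  -- xLow c r = lowShape r (2 (c ∸ r)) and xHigh c r = highShape (2c ∸ r) (2 (r ∸ c) + 1)
  -- hold by definition.
  lowShape : ℕ → ℕ → ℕ → ℤ
  lowShape p L i = if i ℕ.<ᵇ p then + 0 else if i ≡ᵇ p then - (+ L) else if i ≤ᵇ p ℕ.+ L then + 1 else + 0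

  highShape : ℕ → ℕ → ℕ → ℤ
  highShape s L i =
    if i ℕ.<ᵇ s then + 0 else if i ℕ.<ᵇ s ℕ.+ L then - (+ 1) else if i ≡ᵇ s ℕ.+ L then + L else + 0

  lowShape-shift : ∀ p L i → lowShape (suc p) L i ≡ shift (lowShape p L) i
  lowShape-shift p L zero          = refl
  lowShape-shift p L (suc zero)    = refl
  lowShape-shift p L (suc (suc i)) = refl

  highShape-shift : ∀ s L i → highShape (suc s) L i ≡ shift (highShape s L) i
  highShape-shift s L zero    = refl
  highShape-shift s L (suc i) = refl

  lowShape-beyond : ∀ p L i → p ℕ.+ L < i → lowShape p L i ≡ + 0
  lowShape-beyond p L i p+L<i
    rewrite ≮⇒<ᵇ-false (ℕP.<⇒≯ (ℕP.≤-<-trans (ℕP.m≤m+n p L) p+L<i))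
          | ≢⇒≡ᵇ-false (ℕP.>⇒≢ (ℕP.≤-<-trans (ℕP.m≤m+n p L) p+L<i))
          | ≰⇒≤ᵇ-false (ℕP.<⇒≱ p+L<i) = refl

  highShape-beyond : ∀ s L i → s ℕ.+ L < i → highShape s L i ≡ + 0
  highShape-beyond s L i s+L<i
    rewrite ≮⇒<ᵇ-false (ℕP.<⇒≯ (ℕP.≤-<-trans (ℕP.m≤m+n s L) s+L<i))
          | ≮⇒<ᵇ-false (ℕP.<⇒≯ s+L<i)
          | ≢⇒≡ᵇ-false (ℕP.>⇒≢ s+L<i) = refl

  lowShape-at-p : ∀ p L → lowShape p L p ≡ - (+ L)
  lowShape-at-p p L rewrite ≮⇒<ᵇ-false {p} {p} (ℕP.<-irrefl refl) | ≡ᵇ-refl p = refl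

  highShape-at-s : ∀ s L → 0 < L → highShape s L s ≡ - (+ 1)
  highShape-at-s s L 0<L rewrite ≮⇒<ᵇ-false {s} {s} (ℕP.<-irrefl refl) | <⇒<ᵇ-true (ℕP.m<m+n s 0<L) = refl

  dominating-prefix : ∀ L m → m ≤ L → sumℕ (suc m) (lowShape 0 L) ≡ - (+ L) + + m * + 1
  dominating-prefix L m m≤L = cong (λ s → - (+ L) + s) (trans
    (sumℕ-cong m (λ i i<m → cong (λ b → if b then + 1 else + 0) (≤⇒≤ᵇ-true (ℕP.≤-trans i<m m≤L))))
    (sumℕ-const m (+ 1)))

  Eigenpair-dominating : ∀ L → Eigenpair L (+ suc L) (lowShape 0 L)
  Eigenpair-dominating L zero _ = begin
      + suc L * - (+ L) - sumℕ (suc L) (lowShape 0 L)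
    ≡⟨ cong (λ s → + suc L * - (+ L) - s) (dominating-prefix L L ℕP.≤-refl) ⟩
      + suc L * - (+ L) - (- (+ L) + + L * + 1)
    ≡⟨ lemma (+ suc L) (+ L) ⟩
      + suc L * - (+ L) ∎
    where
    lemma : ∀ n l → n * - l - (- l + l * + 1) ≡ n * - l
    lemma = solve-∀
  Eigenpair-dominating L (suc a) a<L
    rewrite ℕP.+-∸-assoc 1 a<L | ≤⇒≤ᵇ-true a<L = begin
      + suc m * + 1 - sumℕ (suc m) (lowShape 0 L)
    ≡⟨ cong (λ s → + suc m * + 1 - s) (dominating-prefix L m (ℕP.m∸n≤m L (suc a))) ⟩
      + suc m * + 1 - (- (+ L) + + m * + 1)
    ≡⟨ lemma (+ m) (+ L) ⟩
      + suc L * + 1 ∎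
    where
    m = L ∸ suc a
    lemma : ∀ m l → (+ 1 + m) * + 1 - (- l + m * + 1) ≡ (+ 1 + l) * + 1
    lemma = solve-∀

  pendant-prefix : ∀ L m → m ≤ L → sumℕ (suc m) (highShape 1 L) ≡ + 0 + + m * - (+ 1)
  pendant-prefix L m m≤L = cong (λ s → + 0 + s) (trans
    (sumℕ-cong m (λ i i<m → cong (λ b → if b then - (+ 1) else (if i ≡ᵇ L then + L else + 0))
                                  (<⇒<ᵇ-true (ℕP.<-≤-trans i<m m≤L))))
    (sumℕ-const m (- (+ 1))))

  pendant-last : ∀ L → highShape 1 L (suc L) ≡ + L
  pendant-last L rewrite ≮⇒<ᵇ-false {L} {L} (ℕP.<-irrefl refl) | ≡ᵇ-refl L = refl

  Eigenpair-pendant : ∀ L → Eigenpair (suc L) (+ 1) (highShape 1 L)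
  Eigenpair-pendant L zero _ = begin
      + suc (suc L) * + 0 - sumℕ (suc (suc L)) (highShape 1 L)
    ≡⟨ cong (λ s → + suc (suc L) * + 0 - s)
         (trans (sumℕ-snoc (suc L) (highShape 1 L)) (cong₂ _+_ (pendant-prefix L L ℕP.≤-refl) (pendant-last L))) ⟩
      + suc (suc L) * + 0 - ((+ 0 + + L * - (+ 1)) + + L)
    ≡⟨ lemma (+ suc (suc L)) (+ L) ⟩
      + 1 * + 0 ∎
    where
    lemma : ∀ n l → n * + 0 - ((+ 0 + l * - (+ 1)) + l) ≡ + 1 * + 0
    lemma = solve-∀
  Eigenpair-pendant L (suc a) (s≤s a≤L) with a ℕP.≟ L
  ... | yes refl rewrite ℕP.m+n∸n≡m 1 a | pendant-last a = lemma (+ a)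
    where
    lemma : ∀ l → + 1 * l - (+ 0 + + 0) ≡ + 1 * l
    lemma = solve-∀
  ... | no a≢L rewrite ℕP.+-∸-assoc 1 a≤L | <⇒<ᵇ-true (ℕP.≤∧≢⇒< a≤L a≢L) = begin
      + suc m * - (+ 1) - sumℕ (suc m) (highShape 1 L)
    ≡⟨ cong (λ s → + suc m * - (+ 1) - s) (pendant-prefix L m (ℕP.m∸n≤m L a)) ⟩
      + suc m * - (+ 1) - (+ 0 + + m * - (+ 1))
    ≡⟨ lemma (+ m) ⟩
      + 1 * - (+ 1) ∎
    where
    m = L ∸ a
    lemma : ∀ m → (+ 1 + m) * - (+ 1) - (+ 0 + m * - (+ 1)) ≡ + 1 * - (+ 1)
    lemma = solve-∀

  Eigenpair-lowShape : ∀ p L → Eigenpair (p ℕ.+ p ℕ.+ L) (+ suc (p ℕ.+ L)) (lowShape p L)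
  Eigenpair-lowShape zero    L = Eigenpair-dominating L
  Eigenpair-lowShape (suc p) L = subst (λ K → Eigenpair K (+ suc (suc p ℕ.+ L)) (lowShape (suc p) L)) (sym (size p L))
    (Eigenpair-cong {λ′ = + suc (suc p ℕ.+ L)} (lowShape-shift p L)
      (Eigenpair-shift {λ′ = λ′} previous beyond (trans (Eigenpair-sum {λ′ = λ′} previous) (sum-vanishes p))))
    where
    λ′ = + suc (p ℕ.+ L)
    previous : Eigenpair (p ℕ.+ p ℕ.+ L) λ′ (lowShape p L)
    previous = Eigenpair-lowShape p L
    size : ∀ p L → suc p ℕ.+ suc p ℕ.+ L ≡ suc (suc (p ℕ.+ p ℕ.+ L))
    size = NS.solve-∀
    beyond : lowShape p L (suc (p ℕ.+ p ℕ.+ L)) ≡ + 0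
    beyond = lowShape-beyond p L _ (s≤s (ℕP.+-monoˡ-≤ L (ℕP.m≤m+n p p)))
    sum-vanishes : ∀ p → (+ suc (p ℕ.+ p ℕ.+ L) - + suc (p ℕ.+ L)) * lowShape p L 0 ≡ + 0
    sum-vanishes zero    = trans (cong (_* - (+ L)) (ℤP.+-inverseʳ (+ suc L))) (ℤP.*-zeroˡ (- (+ L)))
    sum-vanishes (suc p) = ℤP.*-zeroʳ (+ suc (suc p ℕ.+ suc p ℕ.+ L) - + suc (suc p ℕ.+ L))

  Eigenpair-highShape : ∀ s L → Eigenpair (suc (s ℕ.+ s ℕ.+ L)) (+ suc s) (highShape (suc s) L)
  Eigenpair-highShape zero    L = Eigenpair-pendant L
  Eigenpair-highShape (suc s) L = subst (λ K → Eigenpair K (+ suc (suc s)) (highShape (suc (suc s)) L)) (sym (size s L))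
    (Eigenpair-cong {λ′ = + suc (suc s)} (highShape-shift (suc s) L)
      (Eigenpair-shift {λ′ = λ′} previous beyond
        (trans (Eigenpair-sum {λ′ = λ′} previous) (ℤP.*-zeroʳ (+ suc (suc (s ℕ.+ s ℕ.+ L)) - λ′)))))
    where
    λ′ = + suc s
    previous : Eigenpair (suc (s ℕ.+ s ℕ.+ L)) λ′ (highShape (suc s) L)
    previous = Eigenpair-highShape s L
    size : ∀ s L → suc (suc s ℕ.+ suc s ℕ.+ L) ≡ suc (suc (suc (s ℕ.+ s ℕ.+ L)))
    size = NS.solve-∀
    beyond : highShape (suc s) L (suc (suc (s ℕ.+ s ℕ.+ L))) ≡ + 0
    beyond = highShape-beyond (suc s) L _ (s≤s (s≤s (ℕP.+-monoˡ-≤ L (ℕP.m≤m+n s s))))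

  Eigenpair-highShape′ : ∀ K s L → 0 < s → s ℕ.+ s ℕ.+ L ≡ suc K → Eigenpair K (+ s) (highShape s L)
  Eigenpair-highShape′ K (suc s) L _ size =
    subst (λ K → Eigenpair K (+ suc s) (highShape (suc s) L)) (ℕP.suc-injective (trans (reorder s L) size))
          (Eigenpair-highShape s L)
    where
    reorder : ∀ s L → suc (suc (s ℕ.+ s ℕ.+ L)) ≡ suc s ℕ.+ suc s ℕ.+ L
    reorder = NS.solve-∀

  xMid≗highShape : ∀ c i → xMid c i ≡ highShape c 1 i
  xMid≗highShape zero    zero          = refl
  xMid≗highShape zero    (suc zero)    = refl
  xMid≗highShape zero    (suc (suc i)) = refl
  xMid≗highShape (suc c) zero          = refl
  xMid≗highShape (suc c) (suc i)       = xMid≗highShape c i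

  toℕ≤2c : ∀ c (i : Fin (2 ℕ.* c ℕ.+ 1)) → toℕ i ≤ 2 ℕ.* c
  toℕ≤2c c i = ℕP.≤-pred (subst (toℕ i <_) (2c+1≡1+2c c) (FP.toℕ<n i))

  L⁺-action : ∀ c (x : ℕ → ℤ) (i : Fin (2 ℕ.* c ℕ.+ 1)) →
    (L⁺ c · (λ j → x (toℕ j))) i ≡ laplacianAction (2 ℕ.* c) x (toℕ i)
  L⁺-action c x i = begin
      ∑ (λ j → L⁺ c i j * x (toℕ j))
    ≡⟨ ∑≡sumℕ _ Lx (λ j → cong (_* x (toℕ j)) (L⁺≡laplacianℕ c i j)) ⟩
      sumℕ (2 ℕ.* c ℕ.+ 1) Lx
    ≡⟨ cong (λ n → sumℕ n Lx) (2c+1≡1+2c c) ⟩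
      sumℕ (suc (2 ℕ.* c)) Lx
    ≡⟨ laplacianℕ-action (2 ℕ.* c) x (toℕ i) (toℕ≤2c c i) ⟩
      laplacianAction (2 ℕ.* c) x (toℕ i) ∎
    where
    Lx : ℕ → ℤ
    Lx b = laplacianℕ (2 ℕ.* c) (toℕ i) b * x b

  eigenvector : ∀ c λ′ (x : ℕ → ℤ) k → k ≤ 2 ℕ.* c → x k ≢ + 0 → Eigenpair (2 ℕ.* c) λ′ x →
    IsEigenvector (L⁺ c) λ′ (λ i → x (toℕ i))
  eigenvector c λ′ x k k≤2c xₖ≢0 x-eigen =
    nonzero , λ i → trans (L⁺-action c x i) (x-eigen (toℕ i) (toℕ≤2c c i))
    where
    k<n : k < 2 ℕ.* c ℕ.+ 1
    k<n = subst (k <_) (sym (2c+1≡1+2c c)) (s≤s k≤2c)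
    nonzero : ¬ (∀ i → x (toℕ i) ≡ + 0)
    nonzero x≡0 = xₖ≢0 (subst (λ j → x j ≡ + 0) (FP.toℕ-fromℕ< k<n) (x≡0 (F.fromℕ< k<n)))

  xLow-eigenvector : ∀ c r → r < c → IsEigenvector (L⁺ c) (+ (2 ℕ.* c ℕ.+ 1 ∸ r)) (λ i → xLow c r (toℕ i))
  xLow-eigenvector c r r<c = eigenvector c (+ (2 ℕ.* c ℕ.+ 1 ∸ r)) (xLow c r) r r≤2c
    (-[+n]≢0 0<L ∘ trans (sym (lowShape-at-p r L)))
    (subst₂ (λ K λ′ → Eigenpair K (+ λ′) (lowShape r L)) size value (Eigenpair-lowShape r L))
    where
    L = 2 ℕ.* (c ∸ r)
    r+d≡c : r ℕ.+ (c ∸ r) ≡ c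
    r+d≡c = ℕP.m+[n∸m]≡n (ℕP.<⇒≤ r<c)
    0<L : 0 < L
    0<L = ℕP.*-monoʳ-< 2 (ℕP.m<n⇒0<n∸m r<c)
    r≤2c : r ≤ 2 ℕ.* c
    r≤2c = ℕP.≤-trans (ℕP.<⇒≤ r<c) (ℕP.m≤m+n c (c ℕ.+ 0))
    size : r ℕ.+ r ℕ.+ L ≡ 2 ℕ.* c
    size = trans (lemma r (c ∸ r)) (cong (2 ℕ.*_) r+d≡c)
      where
      lemma : ∀ r d → r ℕ.+ r ℕ.+ 2 ℕ.* d ≡ 2 ℕ.* (r ℕ.+ d)
      lemma = NS.solve-∀
    value : suc (r ℕ.+ L) ≡ 2 ℕ.* c ℕ.+ 1 ∸ r
    value = trans (sym (ℕP.m+n∸m≡n r (suc (r ℕ.+ L))))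
                  (cong (_∸ r) (trans (lemma r (c ∸ r)) (cong (λ c → 2 ℕ.* c ℕ.+ 1) r+d≡c)))
      where
      lemma : ∀ r d → r ℕ.+ suc (r ℕ.+ 2 ℕ.* d) ≡ 2 ℕ.* (r ℕ.+ d) ℕ.+ 1
      lemma = NS.solve-∀

  xMid-eigenvector : ∀ c → 1 ≤ c → IsEigenvector (L⁺ c) (+ c) (λ i → xMid c (toℕ i))
  xMid-eigenvector c 1≤c = eigenvector c (+ c) (xMid c) c (ℕP.m≤m+n c (c ℕ.+ 0))
    (-[+n]≢0 (s≤s z≤n) ∘ trans (sym (trans (xMid≗highShape c c) (highShape-at-s c 1 (s≤s z≤n)))))
    (Eigenpair-cong {λ′ = + c} (xMid≗highShape c) (Eigenpair-highShape′ (2 ℕ.* c) c 1 1≤c (lemma c)))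
    where
    lemma : ∀ c → c ℕ.+ c ℕ.+ 1 ≡ suc (2 ℕ.* c)
    lemma = NS.solve-∀

  xHigh-eigenvector : ∀ c r → c ℕ.+ 1 ≤ r → r ≤ 2 ℕ.* c ∸ 1 →
    IsEigenvector (L⁺ c) (+ (2 ℕ.* c ∸ r)) (λ i → xHigh c r (toℕ i))
  xHigh-eigenvector c r c+1≤r r≤2c-1 = eigenvector c (+ s) (highShape s L) s (ℕP.m∸n≤m (2 ℕ.* c) r)
    (-[+n]≢0 (s≤s z≤n) ∘ trans (sym (highShape-at-s s L (ℕP.m≤n+m 1 (2 ℕ.* q)))))
    (Eigenpair-highShape′ (2 ℕ.* c) s L 0<s size)
    where
    s = 2 ℕ.* c ∸ r
    q = r ∸ c
    L = 2 ℕ.* q ℕ.+ 1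
    1≤2c : 1 ≤ 2 ℕ.* c
    1≤2c = ℕP.≤-trans (ℕP.m≤n+m 1 c) (ℕP.≤-trans c+1≤r (ℕP.≤-trans r≤2c-1 (ℕP.m∸n≤m (2 ℕ.* c) 1)))
    r<2c : r < 2 ℕ.* c
    r<2c = subst (_≤ 2 ℕ.* c) (ℕP.+-comm r 1) (ℕP.m≤o∸n⇒m+n≤o r 1≤2c r≤2c-1)
    0<s : 0 < s
    0<s = ℕP.m<n⇒0<n∸m r<2c
    s+q≡c : s ℕ.+ q ≡ c
    s+q≡c = ℕP.+-cancelʳ-≡ c (s ℕ.+ q) c (begin
        s ℕ.+ q ℕ.+ c     ≡⟨ lemma s q c ⟩
        s ℕ.+ (c ℕ.+ q)   ≡⟨ cong (s ℕ.+_) (ℕP.m+[n∸m]≡n (ℕP.≤-trans (ℕP.m≤m+n c 1) c+1≤r)) ⟩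
        s ℕ.+ r           ≡⟨ ℕP.m∸n+n≡m (ℕP.<⇒≤ r<2c) ⟩
        2 ℕ.* c           ≡⟨ cong (c ℕ.+_) (ℕP.+-identityʳ c) ⟩
        c ℕ.+ c ∎)
      where
      lemma : ∀ s q c → s ℕ.+ q ℕ.+ c ≡ s ℕ.+ (c ℕ.+ q)
      lemma = NS.solve-∀
    size : s ℕ.+ s ℕ.+ L ≡ suc (2 ℕ.* c)
    size = trans (lemma s q) (cong (λ c → suc (2 ℕ.* c)) s+q≡c)
      where
      lemma : ∀ s q → s ℕ.+ s ℕ.+ (2 ℕ.* q ℕ.+ 1) ≡ suc (2 ℕ.* (s ℕ.+ q))
      lemma = NS.solve-∀

  xTop-eigenvector : ∀ c → IsEigenvector (L⁺ c) (+ 0) (λ i → xTop (toℕ i))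
  xTop-eigenvector c = eigenvector c (+ 0) (λ _ → + 1) 0 z≤n (λ ()) (Eigenpair-constant (2 ℕ.* c))

open ThresholdGraph using (charPoly-L⁺; xLow-eigenvector; xMid-eigenvector; xHigh-eigenvector; xTop-eigenvector)

open import Data.Nat using (ℕ; _≤_; _<_; _+_; _*_; _∸_)
open import Data.Integer using (ℤ; +_; _-_)
open import Data.Fin using (toℕ)
open import Data.List using (map)
open import Data.Product using (_×_; _,_)
open import Relation.Binary.PropositionalEquality using (_≡_)

mainTheorem1 : (c : ℕ) → 1 ≤ c →
    -- Laplacian spectrum: det(t I - L) = ∏_{λ ∈ {0..c} ∪ {c+2..2c+1}} (t - λ)
    ((t : ℤ) → charPoly (L⁺ c) t ≡ prodℤ (map (λ k → t - (+ k)) (spectrum c)))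
    × ((r : ℕ) → r < c →
         IsEigenvector (L⁺ c) (+ (2 * c + 1 ∸ r)) (λ i → xLow c r (toℕ i)))
    × IsEigenvector (L⁺ c) (+ c) (λ i → xMid c (toℕ i))
    × ((r : ℕ) → c + 1 ≤ r → r ≤ 2 * c ∸ 1 →
         IsEigenvector (L⁺ c) (+ (2 * c ∸ r)) (λ i → xHigh c r (toℕ i)))
    × IsEigenvector (L⁺ c) (+ 0) (λ i → xTop (toℕ i))
mainTheorem1 c 1≤c =
  charPoly-L⁺ c , xLow-eigenvector c , xMid-eigenvector c 1≤c , xHigh-eigenvector c , xTop-eigenvector c
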